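{- Let $h$ be a random tornado tabulation hash function with $d$ derived characters, $\varphi$ a selector, and $X,X_\alpha,\mathcal J,f$ as in the context. Then for every $\alpha\in\Sigma$ and every $i\in\mathbb N$, \[ \Pr\big[|X_\alpha|\ge i\wedge\mathcal J\big]\le\frac{f^i}{i!}. \]
   Context: $\Sigma$ is identified with $k$-bit strings under XOR, $\mathcal R=[2^r]$ with $r$-bit strings. Simple tabulation $g:\Sigma^m\to\mathcal R'$: independent fully random tables, $g(y)=\bigoplus_jT_j[y_j]$. Tornado tabulation with $d$ derived characters: derived key $\tilde x\in\Sigma^{c+d}$ of $x=x_1\cdots x_c$ has $\tilde x_i=x_i$ ($i<c$), $\tilde x_c=x_c\oplus h_0(x_1\cdots x_{c-1})$, $\tilde x_{c+i}=\tilde h_i(\tilde x_1\cdots\tilde x_{c+i-1})$ ($1\le i\le d$), $h_0,\tilde h_i$ simple tabulation into $\Sigma$; $h(x)=\hat h(\tilde x)$ for simple tabulation $\hat h:\Sigma^{c+d}\to\mathcal R$; all tables independent. Selector $\varphi:\Sigma^c\times\mathcal R\to\{0,1\}$ with $\varphi(x,r)$ depending only on $x$ and fixed bits of $r$; $X=\{x:\varphi(x,h(x))=1\}$, $\mu=\mathbb E|X|$, $f=\mu/|\Sigma|$. $X_\alpha=\{x\in X:\tilde x_{c+d}=\alpha\}$. Keys are viewed as sets of position characters; a family of keys is linearly independent if no nonempty subfamily has every position character occurring an even number of times. $\mathcal J$ is the event that $(\tilde x_1\cdots\tilde x_{c+d-1})_{x\in X}$ is linearly independent. -}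

module Defs where

open import Data.Bool using (Bool; true; false; _xor_; not; _∧_; _∨_; if_then_else_)
open import Data.Nat using (ℕ; zero; suc; _+_; _*_; _^_; _≤_; _≡ᵇ_; _≤ᵇ_; _%_)
open import Data.Fin using (Fin; zero; suc; toℕ)
open import Data.List using (List; []; _∷_; map; concatMap; length; filter; allFin)
open import Data.Bool.ListAction using (all; any)
open import Data.Nat.ListAction using (sum)
open import Data.Vec using (Vec; []; _∷_; lookup; replicate; zipWith; _∷ʳ_; init; last)
import Data.Vec.Properties as VecP
open import Data.Bool.Properties using () renaming (_≟_ to _≟B_)
open import Relation.Nullary.Decidable using (⌊_⌋)
open import Relation.Binary.PropositionalEquality using (_≡_)
open import Data.Bool using (T?)
open import Data.Unit using (⊤; tt)
open import Data.Product using (_×_; _,_)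

-- k-bit strings (Σ is Vec Bool k, ℛ is Vec Bool r)
Bits : ℕ → Set
Bits n = Vec Bool n

_⊕_ : {n : ℕ} → Bits n → Bits n → Bits n
_⊕_ = zipWith _xor_

𝟎 : {n : ℕ} → Bits n
𝟎 = replicate _ false

_==_ : {n : ℕ} → Bits n → Bits n → Bool
u == v = ⌊ VecP.≡-dec _≟B_ u v ⌋

-- Enumerations (used to define uniform probability over finite spaces)

allVecsOf : {A : Set} → List A → (n : ℕ) → List (Vec A n)
allVecsOf L zero    = [] ∷ []
allVecsOf L (suc n) = concatMap (λ a → map (a ∷_) (allVecsOf L n)) L

allBits : (n : ℕ) → List (Bits n)
allBits = allVecsOf (false ∷ true ∷ [])

allFunsBits : {A : Set} → (n : ℕ) → List A → List (Bits n → A)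
allFunsBits zero L = map (λ a _ → a) L
allFunsBits (suc n) L =
  concatMap (λ f → map (λ g → λ { (false ∷ v) → f v ; (true ∷ v) → g v })
                       (allFunsBits n L))
            (allFunsBits n L)

allDepFin : (n : ℕ) (P : Fin n → Set) → ((i : Fin n) → List (P i)) → List ((i : Fin n) → P i)
allDepFin zero    P E = (λ ()) ∷ []
allDepFin (suc n) P E =
  concatMap (λ p0 → map (λ rest → λ { zero → p0 ; (suc i) → rest i })
                        (allDepFin n (λ i → P (suc i)) (λ i → E (suc i))))
            (E zero)

count : {A : Set} → (A → Bool) → List A → ℕ
count p L = length (filter (λ a → T? (p a)) L)

Tables : (k m b : ℕ) → Set
Tables k m b = Fin m → Bits k → Bits b

allTables : (k m b : ℕ) → List (Tables k m b)
allTables k m b = allDepFin m (λ _ → Bits k → Bits b) (λ _ → allFunsBits k (allBits b))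

simpleTab : {k m b : ℕ} → Tables k m b → Vec (Bits k) m → Bits b
simpleTab {m = zero}  T []       = 𝟎
simpleTab {m = suc m} T (y ∷ ys) = T zero y ⊕ simpleTab (λ j → T (suc j)) ys

-- Tornado tabulation.  Keys have c = suc c₀ characters from Σ = Bits k,
-- d derived characters, hash values in ℛ = Bits r.
-- Derived keys have c + d = suc (d + c₀) characters.

-- Tables of the derived-character functions h̃₁ … h̃ₙ, where
-- h̃_{m+1} : Σ^(c+m) → Σ  (c + m = suc (m + c₀))
DerivedTables : (k c₀ n : ℕ) → Set
DerivedTables k c₀ zero    = ⊤
DerivedTables k c₀ (suc n) = DerivedTables k c₀ n × Tables k (suc (n + c₀)) k

allDerivedTables : (k c₀ n : ℕ) → List (DerivedTables k c₀ n)
allDerivedTables k c₀ zero    = tt ∷ []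
allDerivedTables k c₀ (suc n) =
  concatMap (λ ts → map (ts ,_) (allTables k (suc (n + c₀)) k)) (allDerivedTables k c₀ n)

record Tornado (k r c₀ d : ℕ) : Set where
  field
    T₀ : Tables k c₀ k
    T̃  : DerivedTables k c₀ d
    T̂  : Tables k (suc (d + c₀)) r

-- uniform choice of all (independent, fully random) tables
--   = uniform over this enumeration of all Tornado records
allTornado : (k r c₀ d : ℕ) → List (Tornado k r c₀ d)
allTornado k r c₀ d =
  concatMap (λ t₀ →
    concatMap (λ t̃ →
      map (λ t̂ → record { T₀ = t₀ ; T̃ = t̃ ; T̂ = t̂ })
          (allTables k (suc (d + c₀)) r))
      (allDerivedTables k c₀ d))
    (allTables k c₀ k)

-- x̃₁ … x̃_{c+n} of a key x ∈ Σ^c, given h₀ and h̃₁ … h̃ₙ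
derivedWith : {k c₀ : ℕ} (n : ℕ) → Tables k c₀ k → DerivedTables k c₀ n →
              Vec (Bits k) (suc c₀) → Vec (Bits k) (suc (n + c₀))
derivedWith zero    T₀ _        x = init x ∷ʳ (last x ⊕ simpleTab T₀ (init x))
derivedWith (suc n) T₀ (ts , T) x =
  let y = derivedWith n T₀ ts x in y ∷ʳ simpleTab T y

module _ {k r c₀ d : ℕ} (H : Tornado k r c₀ d) where
  open Tornado H

  derived : Vec (Bits k) (suc c₀) → Vec (Bits k) (suc (d + c₀))
  derived = derivedWith d T₀ T̃

  hash : Vec (Bits k) (suc c₀) → Bits r
  hash x = simpleTab T̂ (derived x)

DependsOnlyOn : {k r c : ℕ} → (Fin r → Bool) → (Vec (Bits k) c → Bits r → Bool) → Set
DependsOnlyOn {k} {r} {c} S φ =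
  (x : Vec (Bits k) c) (u v : Bits r) →
  ((j : Fin r) → S j ≡ true → lookup u j ≡ lookup v j) → φ x u ≡ φ x v

-- Linear independence of a family of keys y ∈ Σ^m, keys viewed as sets
-- of position characters (j, y_j).

subfamilies : {A : Set} → List A → List (List A)
subfamilies []       = [] ∷ []
subfamilies (a ∷ as) = concatMap (λ s → s ∷ (a ∷ s) ∷ []) (subfamilies as)

isEven : ℕ → Bool
isEven n = n % 2 ≡ᵇ 0

allEven : {k m : ℕ} → List (Vec (Bits k) m) → Bool
allEven {k} {m} Y =
  all (λ j → all (λ a → isEven (count (λ y → lookup y j == a) Y)) (allBits k)) (allFin m)

nonempty : {A : Set} → List A → Bool
nonempty []      = false
nonempty (_ ∷ _) = true

linIndependent : {k m : ℕ} → List (Vec (Bits k) m) → Bool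
linIndependent F = not (any (λ Y → nonempty Y ∧ allEven Y) (subfamilies F))

allKeys : (k c : ℕ) → List (Vec (Bits k) c)
allKeys k c = allVecsOf (allBits k) c

module _ {k r c₀ d : ℕ} (φ : Vec (Bits k) (suc c₀) → Bits r → Bool)
         (H : Tornado k r c₀ d) where

  Xset : List (Vec (Bits k) (suc c₀))
  Xset = filter (λ x → T? (φ x (hash H x))) (allKeys k (suc c₀))

  Xα : Bits k → List (Vec (Bits k) (suc c₀))
  Xα α = filter (λ x → T? (last (derived H x) == α)) Xset

  𝒥 : Bool
  𝒥 = linIndependent (map (λ x → init (derived H x)) Xset)

-- Probabilities over the uniform choice of all tables (as counts)

#Ω : (k r c₀ d : ℕ) → ℕ
#Ω k r c₀ d = length (allTornado k r c₀ d)

#Event : {k r c₀ d : ℕ} → (Vec (Bits k) (suc c₀) → Bits r → Bool) → Bits k → ℕ → ℕ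
#Event {k} {r} {c₀} {d} φ α i =
  count (λ H → (i ≤ᵇ length (Xα φ H α)) ∧ 𝒥 φ H) (allTornado k r c₀ d)

-- Σ_H |X|  (so μ = E|X| = ΣX / #Ω)
ΣX : {k r c₀ d : ℕ} → (Vec (Bits k) (suc c₀) → Bits r → Bool) → ℕ
ΣX {k} {r} {c₀} {d} φ = sum (map (λ H → length (Xset φ H)) (allTornado k r c₀ d))

{-# OPTIONS --safe #-}
module Submission where

-- Instead of subsets of X_α, count ordered i-tuples of keys of X_α whose prefixes
-- x̃₁ … x̃_{c+d-1} are linearly independent: on 𝒥 every tuple of distinct keys of
-- X_α qualifies, so |X_α| ≥ i yields at least i! of them.  Now fix all tables except
-- the one producing the last derived character and that of ĥ.  For a tuple with
-- independent prefixes, simple tabulation makes the last characters independent and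
-- uniform, so they all equal α with probability |Σ|^{-i}; the keys prefix·α are then
-- still independent, so their hash values are independent and uniform and φ selects
-- all of them with probability ∏ q(x)/|ℛ|, q(x) counting the selecting hash values.
-- Summing over all tuples gives i!·Pr ≤ (∑ₓ q(x) / (|ℛ||Σ|))^i = f^i.
-- Uniformity of simple tabulation on independent keys is Gaussian elimination: a key
-- with a position character of odd multiplicity absorbs any shift of that table entry.

import Algebra.Properties.CommutativeSemigroup as CommSemigroupProperties
open import Data.Bool using (Bool; true; false; if_then_else_; _∧_; not; _xor_; T; T?)
open import Data.Bool.Solver using (module xor-∧-Solver)
open import Data.Bool.Properties using (xor-assoc; xor-comm; xor-same; xor-identityʳ) renaming (_≟_ to _≟B_)
open import Data.Nat using (ℕ; zero; suc; _+_; _*_; _^_; _≤_; _≤ᵇ_; _≡ᵇ_; _!; z≤n; s≤s; NonZero; >-nonZero⁻¹)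
open import Data.Nat.Properties
open import Data.Nat.Solver using (module +-*-Solver)
open import Data.Nat.ListAction using (sum)
open import Data.List using (List; []; _∷_; map; concatMap; concat; length; filter; _++_; allFin)
open import Data.Bool.ListAction using (all; any)
open import Data.Vec using (Vec; []; _∷_; zipWith; replicate; lookup; toList; _∷ʳ_; init; last; _⊛_)
open import Data.Fin using (Fin; zero; suc; inject₁)
import Data.Fin.Properties as Fin
import Data.Vec as Vec
import Data.Vec.Properties as VecP
open import Data.Product using (Σ; _×_; _,_; proj₁; proj₂)
open import Data.Sum using (_⊎_; inj₁; inj₂)
open import Function using (_∘_)
open import Relation.Binary using (DecidableEquality)
open import Relation.Nullary using (contradiction)
open import Relation.Nullary.Decidable using (⌊_⌋; yes; no)
open import Data.List.Properties using (++-identityʳ; map-∘; map-cong)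
open import Data.List.Membership.Propositional using (_∈_; lose; find)
open import Data.List.Membership.Propositional.Properties using (∈-concatMap⁺; ∈-concatMap⁻)
open import Data.List.Relation.Unary.Any using (here; there)
open import Data.List.Relation.Unary.Any.Properties using (any⁺; any⁻)
open import Data.Empty using (⊥; ⊥-elim)
open import Data.Unit using (⊤; tt)
open import Relation.Binary.PropositionalEquality

open import Defs

-- Finite sums over lists

∑ : {A : Set} → List A → (A → ℕ) → ℕ
∑ L f = sum (map f L)

syntax ∑ L (λ x → e) = ∑[ x ∈ L ] e

𝟙 : Bool → ℕ
𝟙 true  = 1
𝟙 false = 0

private
  variable
    A B : Set

∑-cong : (L : List A) {f g : A → ℕ} → (∀ x → f x ≡ g x) → ∑ L f ≡ ∑ L g
∑-cong []      f≗g = refl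
∑-cong (x ∷ L) f≗g = cong₂ _+_ (f≗g x) (∑-cong L f≗g)

∑-mono-≤ : (L : List A) {f g : A → ℕ} → (∀ x → f x ≤ g x) → ∑ L f ≤ ∑ L g
∑-mono-≤ []      f≤g = z≤n
∑-mono-≤ (x ∷ L) f≤g = +-mono-≤ (f≤g x) (∑-mono-≤ L f≤g)

∑-++ : (L M : List A) (f : A → ℕ) → ∑ (L ++ M) f ≡ ∑ L f + ∑ M f
∑-++ []      M f = refl
∑-++ (x ∷ L) M f = trans (cong (f x +_) (∑-++ L M f)) (sym (+-assoc (f x) _ _))

∑-map : (h : A → B) (L : List A) (f : B → ℕ) → ∑ (map h L) f ≡ ∑[ a ∈ L ] f (h a)
∑-map h []      f = refl
∑-map h (x ∷ L) f = cong (f (h x) +_) (∑-map h L f)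

∑-concatMap : (h : A → List B) (L : List A) (f : B → ℕ) →
              ∑ (concatMap h L) f ≡ ∑[ a ∈ L ] ∑ (h a) f
∑-concatMap h []      f = refl
∑-concatMap h (x ∷ L) f =
  trans (∑-++ (h x) (concatMap h L) f) (cong (∑ (h x) f +_) (∑-concatMap h L f))

∑-distrib-+ : (L : List A) (f g : A → ℕ) → ∑[ a ∈ L ] (f a + g a) ≡ ∑ L f + ∑ L g
∑-distrib-+ []      f g = refl
∑-distrib-+ (x ∷ L) f g =
  trans (cong (f x + g x +_) (∑-distrib-+ L f g)) (+-interchange (f x) (g x) (∑ L f) (∑ L g))
  where open CommSemigroupProperties +-commutativeSemigroup renaming (interchange to +-interchange)

*-distribˡ-∑ : (c : ℕ) (L : List A) (f : A → ℕ) → c * ∑ L f ≡ ∑[ a ∈ L ] (c * f a)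
*-distribˡ-∑ c []      f = *-zeroʳ c
*-distribˡ-∑ c (x ∷ L) f = trans (*-distribˡ-+ c (f x) (∑ L f)) (cong (c * f x +_) (*-distribˡ-∑ c L f))

*-distribʳ-∑ : (c : ℕ) (L : List A) (f : A → ℕ) → ∑ L f * c ≡ ∑[ a ∈ L ] (f a * c)
*-distribʳ-∑ c L f =
  trans (*-comm (∑ L f) c) (trans (*-distribˡ-∑ c L f) (∑-cong L (λ a → *-comm c (f a))))

∑-const : (L : List A) (c : ℕ) → ∑[ _ ∈ L ] c ≡ length L * c
∑-const []      c = refl
∑-const (x ∷ L) c = cong (c +_) (∑-const L c)

∑-zero : (L : List A) → ∑[ _ ∈ L ] 0 ≡ 0
∑-zero L = trans (∑-const L 0) (*-zeroʳ (length L))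

length≡∑1 : (L : List A) → length L ≡ ∑[ _ ∈ L ] 1
length≡∑1 L = sym (trans (∑-const L 1) (*-identityʳ (length L)))

∑-comm : (L : List A) (M : List B) (f : A → B → ℕ) →
         ∑[ a ∈ L ] ∑[ b ∈ M ] f a b ≡ ∑[ b ∈ M ] ∑[ a ∈ L ] f a b
∑-comm []      M f = sym (∑-zero M)
∑-comm (x ∷ L) M f =
  trans (cong (∑ M (f x) +_) (∑-comm L M f)) (sym (∑-distrib-+ M (f x) (λ b → ∑[ a ∈ L ] f a b)))

∑-filter : (p : A → Bool) (L : List A) (g : A → ℕ) →
           ∑ (filter (λ x → T? (p x)) L) g ≡ ∑[ x ∈ L ] (𝟙 (p x) * g x)
∑-filter p []      g = refl
∑-filter p (x ∷ L) g with p x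
... | true  = cong₂ _+_ (sym (+-identityʳ (g x))) (∑-filter p L g)
... | false = ∑-filter p L g

count≡∑𝟙 : (p : A → Bool) (L : List A) → count p L ≡ ∑[ a ∈ L ] 𝟙 (p a)
count≡∑𝟙 p L = trans (length≡∑1 (filter (λ a → T? (p a)) L)) (trans (∑-filter p L (λ _ → 1)) (∑-cong L (λ a → *-identityʳ (𝟙 (p a)))))

true-∧ : {a : Bool} (b : Bool) → a ≡ true → a ∧ b ≡ b
true-∧ b refl = refl

false-∧ : {a : Bool} (b : Bool) → a ≡ false → a ∧ b ≡ false
false-∧ b refl = refl

𝟙≤1 : ∀ b → 𝟙 b ≤ 1
𝟙≤1 true  = s≤s z≤n
𝟙≤1 false = z≤n

𝟙-∧ : ∀ a b → 𝟙 (a ∧ b) ≡ 𝟙 a * 𝟙 b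
𝟙-∧ true  b = sym (+-identityʳ (𝟙 b))
𝟙-∧ false b = refl

-- Sums over enumerations

∑-allVecsOf-suc : (L : List A) (n : ℕ) (f : Vec A (suc n) → ℕ) →
                  ∑ (allVecsOf L (suc n)) f ≡ ∑[ a ∈ L ] ∑[ w ∈ allVecsOf L n ] f (a ∷ w)
∑-allVecsOf-suc L n f = trans (∑-concatMap _ L f) (∑-cong L (λ a → ∑-map (a ∷_) (allVecsOf L n) f))

length-allVecsOf : (L : List A) (n : ℕ) → length (allVecsOf L n) ≡ length L ^ n
length-allVecsOf L zero    = refl
length-allVecsOf L (suc n) = begin
  length (allVecsOf L (suc n))                 ≡⟨ length≡∑1 (allVecsOf L (suc n)) ⟩
  ∑[ _ ∈ allVecsOf L (suc n) ] 1               ≡⟨ ∑-allVecsOf-suc L n _ ⟩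
  ∑[ _ ∈ L ] ∑[ _ ∈ allVecsOf L n ] 1          ≡⟨ ∑-const L _ ⟩
  length L * ∑[ _ ∈ allVecsOf L n ] 1          ≡⟨ cong (length L *_) (sym (length≡∑1 (allVecsOf L n))) ⟩
  length L * length (allVecsOf L n)            ≡⟨ cong (length L *_) (length-allVecsOf L n) ⟩
  length L * length L ^ n                      ∎
  where open ≡-Reasoning

length-allBits : (b : ℕ) → length (allBits b) ≡ 2 ^ b
length-allBits = length-allVecsOf (false ∷ true ∷ [])

∏ : {n : ℕ} → Vec ℕ n → ℕ
∏ []       = 1
∏ (x ∷ xs) = x * ∏ xs

∑-allVecsOf-∏ : (L : List A) {n : ℕ} (fs : Vec (A → ℕ) n) →
                ∑[ w ∈ allVecsOf L n ] ∏ (fs ⊛ w) ≡ ∏ (Vec.map (∑ L) fs)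
∑-allVecsOf-∏ L []               = refl
∑-allVecsOf-∏ L {suc n} (f ∷ fs) = begin
  ∑[ w ∈ allVecsOf L (suc n) ] ∏ ((f ∷ fs) ⊛ w)             ≡⟨ ∑-allVecsOf-suc L n _ ⟩
  ∑[ a ∈ L ] ∑[ w ∈ allVecsOf L n ] (f a * ∏ (fs ⊛ w))      ≡⟨ ∑-cong L (λ a → *-distribˡ-∑ (f a) (allVecsOf L n) _) ⟨
  ∑[ a ∈ L ] (f a * ∑[ w ∈ allVecsOf L n ] ∏ (fs ⊛ w))      ≡⟨ *-distribʳ-∑ _ L f ⟨
  ∑ L f * ∑[ w ∈ allVecsOf L n ] ∏ (fs ⊛ w)                 ≡⟨ cong (∑ L f *_) (∑-allVecsOf-∏ L fs) ⟩
  ∑ L f * ∏ (Vec.map (∑ L) fs)                              ∎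
  where open ≡-Reasoning

∑-allVecsOf-translate : {C : Set} (L : List A) (_∙_ : A → C → A) →
                        (∀ c (f : A → ℕ) → ∑[ a ∈ L ] f (a ∙ c) ≡ ∑ L f) →
                        (n : ℕ) (δ : Vec C n) (f : Vec A n → ℕ) →
                        ∑[ w ∈ allVecsOf L n ] f (zipWith _∙_ w δ) ≡ ∑ (allVecsOf L n) f
∑-allVecsOf-translate L _∙_ inv zero    []      f = refl
∑-allVecsOf-translate L _∙_ inv (suc n) (c ∷ δ) f = begin
  ∑[ w ∈ allVecsOf L (suc n) ] f (zipWith _∙_ w (c ∷ δ))               ≡⟨ ∑-allVecsOf-suc L n _ ⟩
  ∑[ a ∈ L ] ∑[ w ∈ allVecsOf L n ] f ((a ∙ c) ∷ zipWith _∙_ w δ)      ≡⟨ ∑-cong L (λ a → ∑-allVecsOf-translate L _∙_ inv n δ (λ w → f ((a ∙ c) ∷ w))) ⟩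
  ∑[ a ∈ L ] ∑[ w ∈ allVecsOf L n ] f ((a ∙ c) ∷ w)                    ≡⟨ inv c (λ a → ∑[ w ∈ allVecsOf L n ] f (a ∷ w)) ⟩
  ∑[ a ∈ L ] ∑[ w ∈ allVecsOf L n ] f (a ∷ w)                          ≡⟨ ∑-allVecsOf-suc L n f ⟨
  ∑ (allVecsOf L (suc n)) f                                            ∎
  where open ≡-Reasoning

∑-allBits-⊕ : (b : ℕ) (δ : Bits b) (f : Bits b → ℕ) → ∑[ u ∈ allBits b ] f (u ⊕ δ) ≡ ∑ (allBits b) f
∑-allBits-⊕ = ∑-allVecsOf-translate (false ∷ true ∷ []) _xor_ xor-invariant
  where
  xor-invariant : ∀ c (f : Bool → ℕ) → ∑[ a ∈ false ∷ true ∷ [] ] f (a xor c) ≡ ∑ (false ∷ true ∷ []) f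
  xor-invariant false f = refl
  xor-invariant true  f = begin
    f true + (f false + 0) ≡⟨ cong (f true +_) (+-identityʳ (f false)) ⟩
    f true + f false       ≡⟨ +-comm (f true) (f false) ⟩
    f false + f true       ≡⟨ cong (f false +_) (+-identityʳ (f true)) ⟨
    f false + (f true + 0) ∎
    where open ≡-Reasoning

∑-allVecsOf-allBits-⊕ : (b n : ℕ) (δ : Vec (Bits b) n) (f : Vec (Bits b) n → ℕ) →
                        ∑[ w ∈ allVecsOf (allBits b) n ] f (zipWith _⊕_ w δ) ≡ ∑ (allVecsOf (allBits b) n) f
∑-allVecsOf-allBits-⊕ b = ∑-allVecsOf-translate (allBits b) _⊕_ (∑-allBits-⊕ b)

-- Multiplicities and tuples of distinct elements

module Multiplicity {A : Set} (_≟_ : DecidableEquality A) where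

  mult : A → List A → ℕ
  mult β L = ∑[ x ∈ L ] 𝟙 ⌊ x ≟ β ⌋

  Enumeration : List A → Set
  Enumeration L = ∀ β → mult β L ≡ 1

  AtMostOnce : List A → Set
  AtMostOnce L = ∀ β → mult β L ≤ 1

  𝟙-≟-swap : (x y : A) (g : A → ℕ) → 𝟙 ⌊ y ≟ x ⌋ * g x ≡ 𝟙 ⌊ x ≟ y ⌋ * g y
  𝟙-≟-swap x y g with y ≟ x | x ≟ y
  ... | yes refl | yes _   = refl
  ... | no _     | no _    = refl
  ... | yes y≡x  | no x≢y  = contradiction (sym y≡x) x≢y
  ... | no y≢x   | yes x≡y = contradiction (sym x≡y) y≢x

  ∑-mult-swap : (M L : List A) (g : A → ℕ) → ∑[ x ∈ M ] (mult x L * g x) ≡ ∑[ y ∈ L ] (mult y M * g y)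
  ∑-mult-swap M L g = begin
    ∑[ x ∈ M ] (mult x L * g x)                    ≡⟨ ∑-cong M (λ x → *-distribʳ-∑ (g x) L _) ⟩
    ∑[ x ∈ M ] ∑[ y ∈ L ] (𝟙 ⌊ y ≟ x ⌋ * g x)      ≡⟨ ∑-comm M L _ ⟩
    ∑[ y ∈ L ] ∑[ x ∈ M ] (𝟙 ⌊ y ≟ x ⌋ * g x)      ≡⟨ ∑-cong L (λ y → ∑-cong M (λ x → 𝟙-≟-swap x y g)) ⟩
    ∑[ y ∈ L ] ∑[ x ∈ M ] (𝟙 ⌊ x ≟ y ⌋ * g y)      ≡⟨ ∑-cong L (λ y → *-distribʳ-∑ (g y) M _) ⟨
    ∑[ y ∈ L ] (mult y M * g y)                    ∎
    where open ≡-Reasoning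

  ∑-mult-enumeration : (U : List A) → Enumeration U → (L : List A) (g : A → ℕ) →
                       ∑[ y ∈ U ] (mult y L * g y) ≡ ∑ L g
  ∑-mult-enumeration U enum L g =
    trans (∑-mult-swap U L g) (∑-cong L (λ y → trans (cong (_* g y) (enum y)) (+-identityʳ (g y))))

  mult-filter : (p : A → Bool) (L : List A) (β : A) → mult β (filter (λ x → T? (p x)) L) ≡ 𝟙 (p β) * mult β L
  mult-filter p L β = begin
    mult β (filter (λ x → T? (p x)) L)           ≡⟨ ∑-filter p L _ ⟩
    ∑[ x ∈ L ] (𝟙 (p x) * 𝟙 ⌊ x ≟ β ⌋)          ≡⟨ ∑-cong L only-β ⟩
    ∑[ x ∈ L ] (𝟙 (p β) * 𝟙 ⌊ x ≟ β ⌋)          ≡⟨ *-distribˡ-∑ (𝟙 (p β)) L _ ⟨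
    𝟙 (p β) * mult β L                           ∎
    where
    open ≡-Reasoning
    only-β : ∀ x → 𝟙 (p x) * 𝟙 ⌊ x ≟ β ⌋ ≡ 𝟙 (p β) * 𝟙 ⌊ x ≟ β ⌋
    only-β x with x ≟ β
    ... | yes refl = refl
    ... | no _     = trans (*-zeroʳ (𝟙 (p x))) (sym (*-zeroʳ (𝟙 (p β))))

  remove : A → List A → List A
  remove a []      = []
  remove a (x ∷ L) = if ⌊ a ≟ x ⌋ then remove a L else x ∷ remove a L

  mult-remove-same : (a : A) (L : List A) → mult a (remove a L) ≡ 0
  mult-remove-same a []      = refl
  mult-remove-same a (x ∷ L) with a ≟ x
  ... | yes _ = mult-remove-same a L
  ... | no a≢x with x ≟ a
  ...   | yes x≡a = contradiction (sym x≡a) a≢x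
  ...   | no _    = mult-remove-same a L

  mult-remove-other : (a β : A) (L : List A) → β ≢ a → mult β (remove a L) ≡ mult β L
  mult-remove-other a β []      β≢a = refl
  mult-remove-other a β (x ∷ L) β≢a with a ≟ x
  ... | no _     = cong (𝟙 ⌊ x ≟ β ⌋ +_) (mult-remove-other a β L β≢a)
  ... | yes refl with a ≟ β
  ...   | yes a≡β = contradiction (sym a≡β) β≢a
  ...   | no _    = mult-remove-other a β L β≢a

  mult-remove-≤ : (a β : A) (L : List A) → mult β (remove a L) ≤ mult β L
  mult-remove-≤ a β L with β ≟ a
  ... | yes refl = subst (_≤ mult a L) (sym (mult-remove-same a L)) z≤n
  ... | no β≢a   = ≤-reflexive (mult-remove-other a β L β≢a)

  length-remove : (a : A) (L : List A) → length (remove a L) + mult a L ≡ length L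
  length-remove a []      = refl
  length-remove a (x ∷ L) with a ≟ x
  ... | yes refl with a ≟ a
  ...   | yes _   = trans (+-suc (length (remove a L)) (mult a L)) (cong suc (length-remove a L))
  ...   | no a≢a  = contradiction refl a≢a
  length-remove a (x ∷ L) | no a≢x with x ≟ a
  ...   | yes x≡a = contradiction (sym x≡a) a≢x
  ...   | no _    = cong suc (length-remove a L)

  AtMostOnce-remove : (a : A) (Z : List A) → AtMostOnce Z → AtMostOnce (remove a Z)
  AtMostOnce-remove a Z once β = ≤-trans (mult-remove-≤ a β Z) (once β)

  all-⊆ : (p : A → Bool) (Z L : List A) → (∀ x → 1 ≤ mult x Z → p x ≡ true) →
          (∀ β → mult β L ≤ mult β Z) → all p L ≡ true
  all-⊆ p Z []      p-on-Z L⊆Z = refl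
  all-⊆ p Z (a ∷ L) p-on-Z L⊆Z = cong₂ _∧_ (p-on-Z a (≤-trans a∈L (L⊆Z a))) (all-⊆ p Z L p-on-Z (λ β → ≤-trans (m≤n+m _ _) (L⊆Z β)))
    where
    a∈L : 1 ≤ 𝟙 ⌊ a ≟ a ⌋ + mult a L
    a∈L with a ≟ a
    ... | yes _   = s≤s z≤n
    ... | no a≢a  = contradiction refl a≢a

  -- The number of ways to pick t₁, t₂, … from Z without repetition; for Z without
  -- duplicates, the indicator of "t lists distinct elements of Z".
  distinctIn : {i : ℕ} → List A → Vec A i → ℕ
  distinctIn Z []      = 1
  distinctIn Z (a ∷ t) = mult a Z * distinctIn (remove a Z) t

  distinctIn-≤1 : {i : ℕ} {Z : List A} → AtMostOnce Z → (t : Vec A i) → distinctIn Z t ≤ 1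
  distinctIn-≤1 once []      = ≤-refl
  distinctIn-≤1 {Z = Z} once (a ∷ t) = *-mono-≤ (once a) (distinctIn-≤1 (AtMostOnce-remove a Z once) t)

  distinctIn-⊆ : {i : ℕ} (Z : List A) (t : Vec A i) → .{{NonZero (distinctIn Z t)}} →
                 ∀ β → mult β (Vec.toList t) ≤ mult β Z
  distinctIn-⊆ Z []      β = z≤n
  distinctIn-⊆ Z (a ∷ t) β with a ≟ β
  ... | yes refl = subst (1 + mult a (Vec.toList t) ≤_) (+-identityʳ _)
                         (+-mono-≤ (>-nonZero⁻¹ (mult a Z) {{m*n≢0⇒m≢0 (mult a Z)}})
                                   (≤-trans t⊆Z∖a (≤-reflexive (mult-remove-same a Z))))
    where t⊆Z∖a = distinctIn-⊆ (remove a Z) t {{m*n≢0⇒n≢0 (mult a Z)}} a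
  ... | no a≢β   = ≤-trans (distinctIn-⊆ (remove a Z) t {{m*n≢0⇒n≢0 (mult a Z)}} β)
                           (≤-reflexive (mult-remove-other a β Z (a≢β ∘ sym)))

  i!≤∑distinctIn : {U : List A} → Enumeration U → (i : ℕ) {Z : List A} → AtMostOnce Z → i ≤ length Z →
                   i ! ≤ ∑ (allVecsOf U i) (distinctIn Z)
  i!≤∑distinctIn enum zero    once i≤|Z| = s≤s z≤n
  i!≤∑distinctIn {U} enum (suc i) {Z} once i≤|Z| = begin
    suc i * i !                                          ≤⟨ *-monoˡ-≤ (i !) i≤|Z| ⟩
    length Z * i !                                       ≡⟨ ∑-const Z (i !) ⟨
    ∑[ _ ∈ Z ] (i !)                                     ≡⟨ ∑-mult-enumeration U enum Z (λ _ → i !) ⟨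
    ∑[ a ∈ U ] (mult a Z * i !)                          ≤⟨ ∑-mono-≤ U remove-first ⟩
    ∑[ a ∈ U ] (mult a Z * ∑ (allVecsOf U i) (distinctIn (remove a Z)))  ≡⟨ ∑-cong U (λ a → *-distribˡ-∑ (mult a Z) (allVecsOf U i) _) ⟩
    ∑[ a ∈ U ] ∑[ t ∈ allVecsOf U i ] (mult a Z * distinctIn (remove a Z) t) ≡⟨ ∑-allVecsOf-suc U i (distinctIn Z) ⟨
    ∑ (allVecsOf U (suc i)) (distinctIn Z)               ∎
    where
    open ≤-Reasoning
    remove-first : ∀ a → mult a Z * i ! ≤ mult a Z * ∑ (allVecsOf U i) (distinctIn (remove a Z))
    remove-first a with mult a Z
    ... | zero  = z≤n
    ... | suc c = *-monoʳ-≤ (suc c) (i!≤∑distinctIn enum i (AtMostOnce-remove a Z once) i≤|Z∖a|)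
      where
      i≤|Z∖a| : i ≤ length (remove a Z)
      i≤|Z∖a| = +-cancelʳ-≤ 1 i (length (remove a Z)) (begin
        i + 1                           ≡⟨ +-comm i 1 ⟩
        suc i                           ≤⟨ i≤|Z| ⟩
        length Z                        ≡⟨ length-remove a Z ⟨
        length (remove a Z) + mult a Z  ≤⟨ +-monoʳ-≤ (length (remove a Z)) (once a) ⟩
        length (remove a Z) + 1         ∎)

allVecsOf-enumeration : {A : Set} (_≟_ : DecidableEquality A) {L : List A} → Multiplicity.Enumeration _≟_ L →
                        (n : ℕ) → Multiplicity.Enumeration (VecP.≡-dec _≟_) (allVecsOf L n)
allVecsOf-enumeration _≟_ {L} enum zero    []      = refl
allVecsOf-enumeration {A} _≟_ {L} enum (suc n) (b ∷ β) = begin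
  ∑[ x ∈ allVecsOf L (suc n) ] 𝟙 ⌊ x ≟ⁿ⁺¹ (b ∷ β) ⌋               ≡⟨ ∑-allVecsOf-suc L n _ ⟩
  ∑[ a ∈ L ] ∑[ w ∈ allVecsOf L n ] 𝟙 ⌊ (a ∷ w) ≟ⁿ⁺¹ (b ∷ β) ⌋    ≡⟨ ∑-cong L (λ a → ∑-cong (allVecsOf L n) (λ w → cong 𝟙 (≟-∷ a w))) ⟩
  ∑[ a ∈ L ] ∑[ w ∈ allVecsOf L n ] 𝟙 (⌊ a ≟ b ⌋ ∧ ⌊ w ≟ⁿ β ⌋)    ≡⟨ ∑-cong L (λ a → ∑-cong (allVecsOf L n) (λ w → 𝟙-∧ ⌊ a ≟ b ⌋ _)) ⟩
  ∑[ a ∈ L ] ∑[ w ∈ allVecsOf L n ] (𝟙 ⌊ a ≟ b ⌋ * 𝟙 ⌊ w ≟ⁿ β ⌋)  ≡⟨ ∑-cong L (λ a → *-distribˡ-∑ (𝟙 ⌊ a ≟ b ⌋) (allVecsOf L n) _) ⟨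
  ∑[ a ∈ L ] (𝟙 ⌊ a ≟ b ⌋ * Multiplicity.mult _≟ⁿ_ β (allVecsOf L n))
                                                                  ≡⟨ ∑-cong L (λ a → cong (𝟙 ⌊ a ≟ b ⌋ *_) (allVecsOf-enumeration _≟_ enum n β)) ⟩
  ∑[ a ∈ L ] (𝟙 ⌊ a ≟ b ⌋ * 1)                                    ≡⟨ ∑-cong L (λ a → *-identityʳ _) ⟩
  Multiplicity.mult _≟_ b L                                       ≡⟨ enum b ⟩
  1                                                               ∎
  where
  open ≡-Reasoning
  _≟ⁿ_ : DecidableEquality (Vec A n)
  _≟ⁿ_ = VecP.≡-dec _≟_
  _≟ⁿ⁺¹_ : DecidableEquality (Vec A (suc n))
  _≟ⁿ⁺¹_ = VecP.≡-dec _≟_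
  ≟-∷ : (a : A) (w : Vec A n) → ⌊ (a ∷ w) ≟ⁿ⁺¹ (b ∷ β) ⌋ ≡ ⌊ a ≟ b ⌋ ∧ ⌊ w ≟ⁿ β ⌋
  ≟-∷ a w with a ≟ b | w ≟ⁿ β
  ... | yes _ | yes _ = refl
  ... | yes _ | no _  = refl
  ... | no _  | _     = refl

allBits-enumeration : (b : ℕ) → Multiplicity.Enumeration (VecP.≡-dec _≟B_) (allBits b)
allBits-enumeration = allVecsOf-enumeration _≟B_ λ { false → refl ; true → refl }

allKeys-enumeration : (k c : ℕ) → Multiplicity.Enumeration (VecP.≡-dec (VecP.≡-dec _≟B_)) (allKeys k c)
allKeys-enumeration k = allVecsOf-enumeration _ (allBits-enumeration k)

-- Shift invariance of sums over tables

-- Without function extensionality, invariance can only be asked of summands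
-- respecting _≈_ (pointwise equality, for tables).
SumInvariant : {A : Set} → List A → (A → A → Set) → (A → A) → Set
SumInvariant {A} L _≈_ σ =
  (Φ : A → ℕ) → (∀ a a' → a ≈ a' → Φ a ≡ Φ a') → ∑[ a ∈ L ] Φ (σ a) ≡ ∑ L Φ

∑-concatMap-map : {A B C : Set} (L : List A) (M : A → List B) (D : A → B → C) (Ψ : C → ℕ) →
                  ∑ (concatMap (λ a → map (D a) (M a)) L) Ψ ≡ ∑[ a ∈ L ] ∑[ b ∈ M a ] Ψ (D a b)
∑-concatMap-map L M D Ψ = trans (∑-concatMap _ L Ψ) (∑-cong L (λ a → ∑-map (D a) (M a) Ψ))

allFunsBits-invariant : {A : Set} (L : List A) (n : ℕ) (τ : Bits n → A → A) →
                        (∀ x (f : A → ℕ) → ∑[ a ∈ L ] f (τ x a) ≡ ∑ L f) →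
                        SumInvariant (allFunsBits n L) _≗_ (λ g x → τ x (g x))
allFunsBits-invariant L zero τ τ-inv Φ resp = begin
  ∑ (map (λ a _ → a) L) (λ g → Φ (λ x → τ x (g x))) ≡⟨ ∑-map _ L _ ⟩
  ∑[ a ∈ L ] Φ (λ x → τ x a)                         ≡⟨ ∑-cong L (λ a → resp _ _ (λ { [] → refl })) ⟩
  ∑[ a ∈ L ] Φ (λ _ → τ [] a)                        ≡⟨ τ-inv [] (λ a → Φ (λ _ → a)) ⟩
  ∑[ a ∈ L ] Φ (λ _ → a)                             ≡⟨ ∑-map _ L _ ⟨
  ∑ (map (λ a _ → a) L) Φ                            ∎
  where open ≡-Reasoning
allFunsBits-invariant {A} L (suc n) τ τ-inv Φ resp = split _ (λ _ _ _ → refl) (λ _ _ _ → refl)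
  where
  open ≡-Reasoning
  M : List (Bits n → A)
  M = allFunsBits n L
  -- D stands for the pattern-matching lambda of allFunsBits, which cannot be named.
  split : (D : (Bits n → A) → (Bits n → A) → Bits (suc n) → A) →
          (∀ f g v → D f g (false ∷ v) ≡ f v) → (∀ f g v → D f g (true ∷ v) ≡ g v) →
          ∑[ h ∈ concatMap (λ f → map (D f) M) M ] Φ (λ x → τ x (h x)) ≡ ∑ (concatMap (λ f → map (D f) M) M) Φ
  split D D-false D-true = begin
    ∑[ h ∈ concatMap (λ f → map (D f) M) M ] Φ (λ x → τ x (h x))  ≡⟨ ∑-concatMap-map M (λ _ → M) D _ ⟩
    ∑[ f ∈ M ] ∑[ g ∈ M ] Φ (λ x → τ x (D f g x))               ≡⟨ ∑-cong M (λ f → ∑-cong M (λ g → resp _ _ (τ-D f g))) ⟩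
    ∑[ f ∈ M ] ∑[ g ∈ M ] Φ (D (τ₀ f) (τ₁ g))                   ≡⟨ ∑-cong M invariant-in-g ⟩
    ∑[ f ∈ M ] ∑[ g ∈ M ] Φ (D (τ₀ f) g)                        ≡⟨ invariant-in-f ⟩
    ∑[ f ∈ M ] ∑[ g ∈ M ] Φ (D f g)                             ≡⟨ ∑-concatMap-map M (λ _ → M) D _ ⟨
    ∑ (concatMap (λ f → map (D f) M) M) Φ                       ∎
    where
    τ₀ τ₁ : (Bits n → A) → Bits n → A
    τ₀ f v = τ (false ∷ v) (f v)
    τ₁ g v = τ (true ∷ v) (g v)
    τ-D : ∀ f g → (λ x → τ x (D f g x)) ≗ D (τ₀ f) (τ₁ g)
    τ-D f g (false ∷ v) = trans (cong (τ (false ∷ v)) (D-false f g v)) (sym (D-false _ _ v))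
    τ-D f g (true ∷ v)  = trans (cong (τ (true ∷ v)) (D-true f g v)) (sym (D-true _ _ v))
    D-congʳ : ∀ f {g g'} → g ≗ g' → D f g ≗ D f g'
    D-congʳ f {g} {g'} g≗g' (false ∷ v) = trans (D-false f g v) (sym (D-false f g' v))
    D-congʳ f {g} {g'} g≗g' (true ∷ v)  = trans (D-true f g v) (trans (g≗g' v) (sym (D-true f g' v)))
    D-congˡ : ∀ g {f f'} → f ≗ f' → D f g ≗ D f' g
    D-congˡ g {f} {f'} f≗f' (false ∷ v) = trans (D-false f g v) (trans (f≗f' v) (sym (D-false f' g v)))
    D-congˡ g {f} {f'} f≗f' (true ∷ v)  = trans (D-true f g v) (sym (D-true f' g v))
    invariant-in-g : ∀ f → ∑[ g ∈ M ] Φ (D (τ₀ f) (τ₁ g)) ≡ ∑[ g ∈ M ] Φ (D (τ₀ f) g)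
    invariant-in-g f = allFunsBits-invariant L n (τ ∘ (true ∷_)) (τ-inv ∘ (true ∷_)) _
                         (λ g g' g≗g' → resp _ _ (D-congʳ _ g≗g'))
    invariant-in-f : ∑[ f ∈ M ] ∑[ g ∈ M ] Φ (D (τ₀ f) g) ≡ ∑[ f ∈ M ] ∑[ g ∈ M ] Φ (D f g)
    invariant-in-f = allFunsBits-invariant L n (τ ∘ (false ∷_)) (τ-inv ∘ (false ∷_)) _
                       (λ f f' f≗f' → ∑-cong M (λ g → resp _ _ (D-congˡ g f≗f')))

allDepFin-invariant : {B : Set} (n : ℕ) (E : Fin n → List B) (_≈_ : B → B → Set) → (∀ b → b ≈ b) →
                      (σ : Fin n → B → B) → (∀ i → SumInvariant (E i) _≈_ (σ i)) →
                      SumInvariant (allDepFin n (λ _ → B) E) (λ T T' → ∀ i → T i ≈ T' i) (λ T i → σ i (T i))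
allDepFin-invariant zero _ _ _ _ _ Φ resp = cong (_+ 0) (resp _ _ (λ ()))
allDepFin-invariant {B} (suc n) E _≈_ refl≈ σ σ-inv Φ resp = split _ (λ _ _ → refl) (λ _ _ _ → refl)
  where
  open ≡-Reasoning
  M : List (Fin n → B)
  M = allDepFin n (λ _ → B) (λ i → E (suc i))
  split : (D : B → (Fin n → B) → Fin (suc n) → B) →
          (∀ p T → D p T zero ≡ p) → (∀ p T i → D p T (suc i) ≡ T i) →
          ∑[ T ∈ concatMap (λ p → map (D p) M) (E zero) ] Φ (λ i → σ i (T i)) ≡ ∑ (concatMap (λ p → map (D p) M) (E zero)) Φ
  split D D-zero D-suc = begin
    ∑[ T ∈ concatMap (λ p → map (D p) M) (E zero) ] Φ (λ i → σ i (T i))  ≡⟨ ∑-concatMap-map (E zero) (λ _ → M) D _ ⟩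
    ∑[ p ∈ E zero ] ∑[ T ∈ M ] Φ (λ i → σ i (D p T i))                  ≡⟨ ∑-cong (E zero) (λ p → ∑-cong M (λ T → resp _ _ (σ-D p T))) ⟩
    ∑[ p ∈ E zero ] ∑[ T ∈ M ] Φ (D (σ zero p) (σ⁺ T))                  ≡⟨ ∑-cong (E zero) invariant-in-tail ⟩
    ∑[ p ∈ E zero ] ∑[ T ∈ M ] Φ (D (σ zero p) T)                       ≡⟨ invariant-in-head ⟩
    ∑[ p ∈ E zero ] ∑[ T ∈ M ] Φ (D p T)                                ≡⟨ ∑-concatMap-map (E zero) (λ _ → M) D _ ⟨
    ∑ (concatMap (λ p → map (D p) M) (E zero)) Φ                        ∎
    where
    σ⁺ : (Fin n → B) → Fin n → B
    σ⁺ T i = σ (suc i) (T i)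
    σ-D : ∀ p T i → σ i (D p T i) ≈ D (σ zero p) (σ⁺ T) i
    σ-D p T zero    rewrite D-zero p T | D-zero (σ zero p) (σ⁺ T) = refl≈ _
    σ-D p T (suc i) rewrite D-suc p T i | D-suc (σ zero p) (σ⁺ T) i = refl≈ _
    D-congʳ : ∀ p {T T'} → (∀ i → T i ≈ T' i) → ∀ i → D p T i ≈ D p T' i
    D-congʳ p {T} {T'} T≈T' zero    rewrite D-zero p T | D-zero p T' = refl≈ _
    D-congʳ p {T} {T'} T≈T' (suc i) rewrite D-suc p T i | D-suc p T' i = T≈T' i
    D-congˡ : ∀ T {p p'} → p ≈ p' → ∀ i → D p T i ≈ D p' T i
    D-congˡ T {p} {p'} p≈p' zero    rewrite D-zero p T | D-zero p' T = p≈p'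
    D-congˡ T {p} {p'} p≈p' (suc i) rewrite D-suc p T i | D-suc p' T i = refl≈ _
    invariant-in-tail : ∀ p → ∑[ T ∈ M ] Φ (D (σ zero p) (σ⁺ T)) ≡ ∑[ T ∈ M ] Φ (D (σ zero p) T)
    invariant-in-tail p = allDepFin-invariant n (E ∘ suc) _≈_ refl≈ (σ ∘ suc) (σ-inv ∘ suc) _
                            (λ T T' T≈T' → resp _ _ (D-congʳ _ T≈T'))
    invariant-in-head : ∑[ p ∈ E zero ] ∑[ T ∈ M ] Φ (D (σ zero p) T) ≡ ∑[ p ∈ E zero ] ∑[ T ∈ M ] Φ (D p T)
    invariant-in-head = σ-inv zero _ (λ p p' p≈p' → ∑-cong M (λ T → resp _ _ (D-congˡ T p≈p')))

_≗ᵀ_ : {k m b : ℕ} → Tables k m b → Tables k m b → Set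
T ≗ᵀ T' = ∀ j → T j ≗ T' j

shiftAt : {k m b : ℕ} → Tables k m b → Fin m → Bits k → Bits b → Tables k m b
shiftAt T j a δ i x = if ⌊ i Fin.≟ j ⌋ ∧ (x == a) then T i x ⊕ δ else T i x

∑-allTables-shiftAt : {k m b : ℕ} (j : Fin m) (a : Bits k) (δ : Bits b) →
                      SumInvariant (allTables k m b) _≗ᵀ_ (λ T → shiftAt T j a δ)
∑-allTables-shiftAt {k} {m} {b} j a δ =
  allDepFin-invariant m _ _≗_ (λ _ _ → refl) (λ i g x → shift i x (g x))
    (λ i → allFunsBits-invariant (allBits b) k (shift i) (shift-invariant i))
  where
  shift : Fin m → Bits k → Bits b → Bits b
  shift i x u = if ⌊ i Fin.≟ j ⌋ ∧ (x == a) then u ⊕ δ else u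
  shift-invariant : ∀ i x (f : Bits b → ℕ) → ∑[ u ∈ allBits b ] f (shift i x u) ≡ ∑ (allBits b) f
  shift-invariant i x f with ⌊ i Fin.≟ j ⌋ ∧ (x == a)
  ... | true  = ∑-allBits-⊕ b δ f
  ... | false = refl

module _ {n : ℕ} where

  ⊕-assoc : (x y z : Bits n) → (x ⊕ y) ⊕ z ≡ x ⊕ (y ⊕ z)
  ⊕-assoc = VecP.zipWith-assoc xor-assoc

  ⊕-comm : (x y : Bits n) → x ⊕ y ≡ y ⊕ x
  ⊕-comm = VecP.zipWith-comm xor-comm

  ⊕-identityˡ : (x : Bits n) → 𝟎 ⊕ x ≡ x
  ⊕-identityˡ = VecP.zipWith-identityˡ (λ _ → refl)

  ⊕-identityʳ : (x : Bits n) → x ⊕ 𝟎 ≡ x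
  ⊕-identityʳ = VecP.zipWith-identityʳ xor-identityʳ

⊕-self : {n : ℕ} (x : Bits n) → x ⊕ x ≡ 𝟎
⊕-self []      = refl
⊕-self (a ∷ x) = cong₂ _∷_ (xor-same a) (⊕-self x)

⊕-interchange : {n : ℕ} (w x y z : Bits n) → (w ⊕ x) ⊕ (y ⊕ z) ≡ (w ⊕ y) ⊕ (x ⊕ z)
⊕-interchange []      []      []      []      = refl
⊕-interchange (a ∷ w) (b ∷ x) (c ∷ y) (d ∷ z) =
  cong₂ _∷_ (solve 4 (λ a b c d → (a :+ b) :+ (c :+ d) := (a :+ c) :+ (b :+ d)) refl a b c d)
            (⊕-interchange w x y z)
  where open xor-∧-Solver

infixr 21 _·_

_·_ : {n : ℕ} → Bool → Bits n → Bits n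
s · u = if s then u else 𝟎

·-distribʳ-xor : {n : ℕ} (s t : Bool) (u : Bits n) → s · u ⊕ t · u ≡ (s xor t) · u
·-distribʳ-xor false t    u = ⊕-identityˡ _
·-distribʳ-xor true false u = ⊕-identityʳ u
·-distribʳ-xor true true  u = ⊕-self u

-- A form is a formal XOR-sum of keys; as for the paper's sets of position
-- characters, only the parity of each position character matters.
Form : ℕ → ℕ → Set
Form k m = List (Vec (Bits k) m)

eval : {k m b : ℕ} → Tables k m b → Form k m → Bits b
eval T []      = 𝟎
eval T (y ∷ F) = simpleTab T y ⊕ eval T F

parity : {k m : ℕ} → Fin m → Bits k → Form k m → Bool
parity j a []      = false
parity j a (y ∷ F) = (lookup y j == a) xor parity j a F

eval-++ : {k m b : ℕ} (T : Tables k m b) (F G : Form k m) → eval T (F ++ G) ≡ eval T F ⊕ eval T G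
eval-++ T []      G = sym (⊕-identityˡ _)
eval-++ T (y ∷ F) G = trans (cong (simpleTab T y ⊕_) (eval-++ T F G)) (sym (⊕-assoc _ _ _))

parity-++ : {k m : ℕ} (j : Fin m) (a : Bits k) (F G : Form k m) →
            parity j a (F ++ G) ≡ parity j a F xor parity j a G
parity-++ j a []      G = refl
parity-++ j a (y ∷ F) G =
  trans (cong ((lookup y j == a) xor_) (parity-++ j a F G)) (sym (xor-assoc (lookup y j == a) _ _))

simpleTab-cong : {k m b : ℕ} {T T' : Tables k m b} → T ≗ᵀ T' → (y : Vec (Bits k) m) → simpleTab T y ≡ simpleTab T' y
simpleTab-cong T≗T' []       = refl
simpleTab-cong T≗T' (y ∷ ys) = cong₂ _⊕_ (T≗T' zero y) (simpleTab-cong (λ j → T≗T' (suc j)) ys)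

eval-cong : {k m b : ℕ} {T T' : Tables k m b} → T ≗ᵀ T' → (F : Form k m) → eval T F ≡ eval T' F
eval-cong T≗T' []      = refl
eval-cong T≗T' (y ∷ F) = cong₂ _⊕_ (simpleTab-cong T≗T' y) (eval-cong T≗T' F)

simpleTab-shiftAt : {k m b : ℕ} (T : Tables k m b) (j : Fin m) (a : Bits k) (δ : Bits b) (y : Vec (Bits k) m) →
                    simpleTab (shiftAt T j a δ) y ≡ simpleTab T y ⊕ (lookup y j == a) · δ
simpleTab-shiftAt {k} {suc m} {b} T zero a δ (y ∷ ys) = begin
  shiftAt T zero a δ zero y ⊕ simpleTab (λ i → shiftAt T zero a δ (suc i)) ys  ≡⟨ cong (shiftAt T zero a δ zero y ⊕_) (simpleTab-cong (λ _ _ → refl) ys) ⟩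
  shiftAt T zero a δ zero y ⊕ simpleTab T⁺ ys                                 ≡⟨ shift-head (y == a) ⟩
  (T zero y ⊕ simpleTab T⁺ ys) ⊕ (y == a) · δ                                ∎
  where
  open ≡-Reasoning
  T⁺ : Tables k m b
  T⁺ i = T (suc i)
  shift-head : ∀ s → (if s then T zero y ⊕ δ else T zero y) ⊕ simpleTab T⁺ ys ≡ (T zero y ⊕ simpleTab T⁺ ys) ⊕ s · δ
  shift-head true  = trans (⊕-assoc (T zero y) δ _) (trans (cong (T zero y ⊕_) (⊕-comm δ _)) (sym (⊕-assoc _ _ δ)))
  shift-head false = sym (⊕-identityʳ _)
simpleTab-shiftAt {k} {suc m} {b} T (suc j) a δ (y ∷ ys) = begin
  T zero y ⊕ simpleTab (λ i → shiftAt T (suc j) a δ (suc i)) ys  ≡⟨ cong (T zero y ⊕_) (simpleTab-cong shiftAt-suc ys) ⟩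
  T zero y ⊕ simpleTab (shiftAt T⁺ j a δ) ys                     ≡⟨ cong (T zero y ⊕_) (simpleTab-shiftAt T⁺ j a δ ys) ⟩
  T zero y ⊕ (simpleTab T⁺ ys ⊕ (lookup ys j == a) · δ)          ≡⟨ ⊕-assoc _ _ _ ⟨
  (T zero y ⊕ simpleTab T⁺ ys) ⊕ (lookup ys j == a) · δ          ∎
  where
  open ≡-Reasoning
  T⁺ : Tables k m b
  T⁺ i = T (suc i)
  suc-≟ : ∀ i → ⌊ suc i Fin.≟ suc j ⌋ ≡ ⌊ i Fin.≟ j ⌋
  suc-≟ i with i Fin.≟ j
  ... | yes _ = refl
  ... | no _  = refl
  shiftAt-suc : (λ i → shiftAt T (suc j) a δ (suc i)) ≗ᵀ shiftAt T⁺ j a δ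
  shiftAt-suc i x = cong (λ s → if s ∧ (x == a) then T⁺ i x ⊕ δ else T⁺ i x) (suc-≟ i)

eval-shiftAt : {k m b : ℕ} (T : Tables k m b) (j : Fin m) (a : Bits k) (δ : Bits b) (F : Form k m) →
               eval (shiftAt T j a δ) F ≡ eval T F ⊕ parity j a F · δ
eval-shiftAt T j a δ []      = sym (⊕-identityʳ 𝟎)
eval-shiftAt T j a δ (y ∷ F) = begin
  simpleTab (shiftAt T j a δ) y ⊕ eval (shiftAt T j a δ) F                ≡⟨ cong₂ _⊕_ (simpleTab-shiftAt T j a δ y) (eval-shiftAt T j a δ F) ⟩
  (simpleTab T y ⊕ (lookup y j == a) · δ) ⊕ (eval T F ⊕ parity j a F · δ) ≡⟨ ⊕-interchange _ _ _ _ ⟩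
  (simpleTab T y ⊕ eval T F) ⊕ ((lookup y j == a) · δ ⊕ parity j a F · δ) ≡⟨ cong ((simpleTab T y ⊕ eval T F) ⊕_) (·-distribʳ-xor _ _ δ) ⟩
  (simpleTab T y ⊕ eval T F) ⊕ parity j a (y ∷ F) · δ                     ∎
  where open ≡-Reasoning

-- Simple tabulation is uniform on independent forms

search-Fin : {m : ℕ} (P Q : Fin m → Set) → (∀ j → P j ⊎ Q j) → Σ (Fin m) P ⊎ (∀ j → Q j)
search-Fin {zero}  P Q P⊎Q = inj₂ (λ ())
search-Fin {suc m} P Q P⊎Q with P⊎Q zero | search-Fin (P ∘ suc) (Q ∘ suc) (P⊎Q ∘ suc)
... | inj₁ p | _            = inj₁ (zero , p)
... | inj₂ q | inj₁ (j , p) = inj₁ (suc j , p)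
... | inj₂ q | inj₂ qs      = inj₂ λ { zero → q ; (suc j) → qs j }

search-Bits : {k : ℕ} (P Q : Bits k → Set) → (∀ a → P a ⊎ Q a) → Σ (Bits k) P ⊎ (∀ a → Q a)
search-Bits {zero} P Q P⊎Q with P⊎Q []
... | inj₁ p = inj₁ ([] , p)
... | inj₂ q = inj₂ λ { [] → q }
search-Bits {suc k} P Q P⊎Q
  with search-Bits (P ∘ (false ∷_)) (Q ∘ (false ∷_)) (P⊎Q ∘ (false ∷_))
     | search-Bits (P ∘ (true ∷_)) (Q ∘ (true ∷_)) (P⊎Q ∘ (true ∷_))
... | inj₁ (a , p) | _            = inj₁ (false ∷ a , p)
... | inj₂ _       | inj₁ (a , p) = inj₁ (true ∷ a , p)
... | inj₂ q₀      | inj₂ q₁      = inj₂ λ { (false ∷ a) → q₀ a ; (true ∷ a) → q₁ a }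

odd-or-even : {k m : ℕ} (F : Form k m) →
              (Σ (Fin m) λ j → Σ (Bits k) λ a → parity j a F ≡ true) ⊎ (∀ j a → parity j a F ≡ false)
odd-or-even F = search-Fin _ _ λ j → search-Bits _ _ λ a → bool-cases (parity j a F)
  where
  bool-cases : (b : Bool) → b ≡ true ⊎ b ≡ false
  bool-cases true  = inj₁ refl
  bool-cases false = inj₂ refl

select : {A : Set} {i : ℕ} → Vec Bool i → Vec A i → List A
select []             []      = []
select (true  ∷ mask) (a ∷ t) = a ∷ select mask t
select (false ∷ mask) (a ∷ t) = select mask t

select-none : {A : Set} {i : ℕ} (t : Vec A i) → select (replicate i false) t ≡ []
select-none []      = refl
select-none (a ∷ t) = select-none t

combine : {k m i : ℕ} → Vec Bool i → Vec (Form k m) i → Form k m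
combine mask Fs = concat (select mask Fs)

Independent : {k m i : ℕ} → Vec (Form k m) i → Set
Independent {i = i} Fs =
  (mask : Vec Bool i) → (∀ j a → parity j a (combine mask Fs) ≡ false) → mask ≡ replicate i false

evals : {k m b i : ℕ} → Tables k m b → Vec (Form k m) i → Vec (Bits b) i
evals T = Vec.map (eval T)

evals-cong : {k m b i : ℕ} {T T' : Tables k m b} → T ≗ᵀ T' → (Fs : Vec (Form k m) i) → evals T Fs ≡ evals T' Fs
evals-cong T≗T' []       = refl
evals-cong T≗T' (F ∷ Fs) = cong₂ _∷_ (eval-cong T≗T' F) (evals-cong T≗T' Fs)

-- One step of Gaussian elimination with pivot (j, a), a position character of odd parity in F₁.
module Elimination {k m : ℕ} (j : Fin m) (a : Bits k) (F₁ : Form k m) (odd : parity j a F₁ ≡ true) where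

  reduce : Form k m → Form k m
  reduce F = if parity j a F then F ++ F₁ else F

  parity-pivot-reduce : ∀ F → parity j a (reduce F) ≡ false
  parity-pivot-reduce F with parity j a F in eq
  ... | true  = trans (parity-++ j a F F₁) (cong₂ _xor_ eq odd)
  ... | false = eq

  parity-reduce : ∀ j' a' F → parity j' a' (reduce F) ≡ parity j' a' F xor (parity j a F ∧ parity j' a' F₁)
  parity-reduce j' a' F with parity j a F
  ... | true  = parity-++ j' a' F F₁
  ... | false = sym (xor-identityʳ _)

  eval-reduce : ∀ {b} (T : Tables k m b) F → eval T F ≡ eval T (reduce F) ⊕ parity j a F · eval T F₁
  eval-reduce T F with parity j a F
  ... | false = sym (⊕-identityʳ _)
  ... | true  = sym (begin
    eval T (F ++ F₁) ⊕ eval T F₁           ≡⟨ cong (_⊕ eval T F₁) (eval-++ T F F₁) ⟩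
    (eval T F ⊕ eval T F₁) ⊕ eval T F₁     ≡⟨ ⊕-assoc _ _ _ ⟩
    eval T F ⊕ (eval T F₁ ⊕ eval T F₁)     ≡⟨ cong (eval T F ⊕_) (⊕-self _) ⟩
    eval T F ⊕ 𝟎                           ≡⟨ ⊕-identityʳ _ ⟩
    eval T F                               ∎)
    where open ≡-Reasoning

  parity-combine-reduce : {i : ℕ} (mask : Vec Bool i) (Fs : Vec (Form k m) i) → ∀ j' a' →
                          parity j' a' (combine mask (Vec.map reduce Fs))
                            ≡ parity j' a' (combine mask Fs) xor (parity j a (combine mask Fs) ∧ parity j' a' F₁)
  parity-combine-reduce []             []       j' a' = refl
  parity-combine-reduce (false ∷ mask) (F ∷ Fs) j' a' = parity-combine-reduce mask Fs j' a'
  parity-combine-reduce (true ∷ mask)  (F ∷ Fs) j' a' = begin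
    parity j' a' (reduce F ++ C')                                       ≡⟨ parity-++ j' a' (reduce F) C' ⟩
    parity j' a' (reduce F) xor parity j' a' C'                         ≡⟨ cong₂ _xor_ (parity-reduce j' a' F) (parity-combine-reduce mask Fs j' a') ⟩
    (π' F xor (π F ∧ π' F₁)) xor (π' C xor (π C ∧ π' F₁))               ≡⟨ solve 5 (λ s t p f c → (f :+ (s :* p)) :+ (c :+ (t :* p)) := (f :+ c) :+ ((s :+ t) :* p)) refl (π F) (π C) (π' F₁) (π' F) (π' C) ⟩
    (π' F xor π' C) xor ((π F xor π C) ∧ π' F₁)                         ≡⟨ cong₂ (λ x y → x xor (y ∧ π' F₁)) (parity-++ j' a' F C) (parity-++ j a F C) ⟨
    π' (F ++ C) xor (π (F ++ C) ∧ π' F₁)                                ∎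
    where
    open ≡-Reasoning
    open xor-∧-Solver
    C C' : Form k m
    C  = combine mask Fs
    C' = combine mask (Vec.map reduce Fs)
    π π' : Form k m → Bool
    π  = parity j a
    π' = parity j' a'

  parity-combine-pivot : {i : ℕ} (t : Bool) (mask : Vec Bool i) (Fs : Vec (Form k m) i) → ∀ j' a' →
                         parity j' a' (combine (t ∷ mask) (F₁ ∷ Fs)) ≡ parity j' a' (combine mask Fs) xor (t ∧ parity j' a' F₁)
  parity-combine-pivot true  mask Fs j' a' = trans (parity-++ j' a' F₁ (combine mask Fs)) (xor-comm (parity j' a' F₁) _)
  parity-combine-pivot false mask Fs j' a' = sym (xor-identityʳ _)

  -- A dependency among the reduced forms lifts to one among F₁ ∷ Fs, taking F₁
  -- exactly when the combination has odd pivot parity.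
  reduce-independent : {i : ℕ} (Fs : Vec (Form k m) i) → Independent (F₁ ∷ Fs) → Independent (Vec.map reduce Fs)
  reduce-independent Fs indep mask even =
    proj₂ (VecP.∷-injective (indep (parity j a (combine mask Fs) ∷ mask) λ j' a' →
      trans (parity-combine-pivot _ mask Fs j' a') (trans (sym (parity-combine-reduce mask Fs j' a')) (even j' a'))))

  evals-reduce : ∀ {b i} (T : Tables k m b) (Fs : Vec (Form k m) i) →
                 evals T Fs ≡ zipWith _⊕_ (evals T (Vec.map reduce Fs)) (Vec.map (λ F → parity j a F · eval T F₁) Fs)
  evals-reduce T []       = refl
  evals-reduce T (F ∷ Fs) = cong₂ _∷_ (eval-reduce T F) (evals-reduce T Fs)

  evals-reduce-shiftAt : ∀ {b i} (T : Tables k m b) (δ : Bits b) (Fs : Vec (Form k m) i) →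
                         evals (shiftAt T j a δ) (Vec.map reduce Fs) ≡ evals T (Vec.map reduce Fs)
  evals-reduce-shiftAt T δ []       = refl
  evals-reduce-shiftAt T δ (F ∷ Fs) = cong₂ _∷_ eval-unchanged (evals-reduce-shiftAt T δ Fs)
    where
    eval-unchanged : eval (shiftAt T j a δ) (reduce F) ≡ eval T (reduce F)
    eval-unchanged = trans (eval-shiftAt T j a δ (reduce F))
                           (trans (cong (λ s → eval T (reduce F) ⊕ s · δ) (parity-pivot-reduce F)) (⊕-identityʳ _))

evals-uniform : {k m b i : ℕ} (Fs : Vec (Form k m) i) → Independent Fs → (G : Vec (Bits b) i → ℕ) →
                (2 ^ b) ^ i * ∑[ T ∈ allTables k m b ] G (evals T Fs)
                  ≡ length (allTables k m b) * ∑ (allVecsOf (allBits b) i) G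
evals-uniform {k} {m} {b} {zero} [] indep G = begin
  1 * ∑[ _ ∈ allTables k m b ] G []          ≡⟨ *-identityˡ _ ⟩
  ∑[ _ ∈ allTables k m b ] G []              ≡⟨ ∑-const (allTables k m b) (G []) ⟩
  length (allTables k m b) * G []            ≡⟨ cong (length (allTables k m b) *_) (+-identityʳ (G [])) ⟨
  length (allTables k m b) * (G [] + 0)      ∎
  where open ≡-Reasoning
evals-uniform {k} {m} {b} {suc i} (F₁ ∷ Fs) indep G with odd-or-even F₁
... | inj₂ even = contradiction (proj₁ (VecP.∷-injective (indep (true ∷ replicate i false) even′))) λ ()
  where
  even′ : ∀ j a → parity j a (F₁ ++ concat (select (replicate i false) Fs)) ≡ false
  even′ j a rewrite select-none Fs | ++-identityʳ F₁ = even j a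
... | inj₁ (j , a , odd) = begin
  (2 ^ b) * (2 ^ b) ^ i * ∑[ T ∈ TT ] G (evals T (F₁ ∷ Fs))       ≡⟨ cong ((2 ^ b) * (2 ^ b) ^ i *_) evals-by-pivot ⟩
  (2 ^ b) * (2 ^ b) ^ i * ∑[ T ∈ TT ] G′ (u T) (W T)             ≡⟨ cong (_* ∑[ T ∈ TT ] G′ (u T) (W T)) (*-comm (2 ^ b) _) ⟩
  (2 ^ b) ^ i * (2 ^ b) * ∑[ T ∈ TT ] G′ (u T) (W T)             ≡⟨ *-assoc ((2 ^ b) ^ i) (2 ^ b) _ ⟩
  (2 ^ b) ^ i * ((2 ^ b) * ∑[ T ∈ TT ] G′ (u T) (W T))           ≡⟨ cong ((2 ^ b) ^ i *_) average-over-pivot ⟩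
  (2 ^ b) ^ i * ∑[ T ∈ TT ] G″ (W T)                             ≡⟨ evals-uniform Fs′ (reduce-independent Fs indep) G″ ⟩
  length TT * ∑ (allVecsOf BB i) G″                              ≡⟨ cong (length TT *_) untranslate ⟩
  length TT * ∑ (allVecsOf BB (suc i)) G                         ∎
  where
  open ≡-Reasoning
  open Elimination j a F₁ odd
  TT : List (Tables k m b)
  TT = allTables k m b
  BB : List (Bits b)
  BB = allBits b
  Fs′ : Vec (Form k m) i
  Fs′ = Vec.map reduce Fs
  u : Tables k m b → Bits b
  u T = eval T F₁
  W : Tables k m b → Vec (Bits b) i
  W T = evals T Fs′
  G′ : Bits b → Vec (Bits b) i → ℕ
  G′ v w = G (v ∷ zipWith _⊕_ w (Vec.map (λ F → parity j a F · v) Fs))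
  G″ : Vec (Bits b) i → ℕ
  G″ w = ∑[ v ∈ BB ] G′ v w

  evals-by-pivot : ∑[ T ∈ TT ] G (evals T (F₁ ∷ Fs)) ≡ ∑[ T ∈ TT ] G′ (u T) (W T)
  evals-by-pivot = ∑-cong TT (λ T → cong (λ w → G (u T ∷ w)) (evals-reduce T Fs))

  -- XOR-ing δ into the pivot entry adds δ to u and leaves the reduced forms unchanged.
  shift-pivot : ∀ δ → ∑[ T ∈ TT ] G′ (u T ⊕ δ) (W T) ≡ ∑[ T ∈ TT ] G′ (u T) (W T)
  shift-pivot δ = trans
    (∑-cong TT λ T → sym (cong₂ G′ (trans (eval-shiftAt T j a δ F₁) (cong (λ s → u T ⊕ s · δ) odd))
                                   (evals-reduce-shiftAt T δ Fs)))
    (∑-allTables-shiftAt j a δ (λ T → G′ (u T) (W T)) λ T T' T≗T' → cong₂ G′ (eval-cong T≗T' F₁) (evals-cong T≗T' Fs′))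

  average-over-pivot : (2 ^ b) * ∑[ T ∈ TT ] G′ (u T) (W T) ≡ ∑[ T ∈ TT ] G″ (W T)
  average-over-pivot = begin
    (2 ^ b) * ∑[ T ∈ TT ] G′ (u T) (W T)             ≡⟨ cong (_* ∑[ T ∈ TT ] G′ (u T) (W T)) (length-allBits b) ⟨
    length BB * ∑[ T ∈ TT ] G′ (u T) (W T)           ≡⟨ ∑-const BB _ ⟨
    ∑[ δ ∈ BB ] ∑[ T ∈ TT ] G′ (u T) (W T)           ≡⟨ ∑-cong BB shift-pivot ⟨
    ∑[ δ ∈ BB ] ∑[ T ∈ TT ] G′ (u T ⊕ δ) (W T)       ≡⟨ ∑-comm BB TT _ ⟩
    ∑[ T ∈ TT ] ∑[ δ ∈ BB ] G′ (u T ⊕ δ) (W T)       ≡⟨ ∑-cong TT (λ T → ∑-cong BB (λ δ → cong (λ v → G′ v (W T)) (⊕-comm (u T) δ))) ⟩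
    ∑[ T ∈ TT ] ∑[ δ ∈ BB ] G′ (δ ⊕ u T) (W T)       ≡⟨ ∑-cong TT (λ T → ∑-allBits-⊕ b (u T) (λ v → G′ v (W T))) ⟩
    ∑[ T ∈ TT ] G″ (W T)                             ∎

  untranslate : ∑ (allVecsOf BB i) G″ ≡ ∑ (allVecsOf BB (suc i)) G
  untranslate = begin
    ∑[ w ∈ allVecsOf BB i ] ∑[ v ∈ BB ] G′ v w       ≡⟨ ∑-comm (allVecsOf BB i) BB _ ⟩
    ∑[ v ∈ BB ] ∑[ w ∈ allVecsOf BB i ] G′ v w       ≡⟨ ∑-cong BB (λ v → ∑-allVecsOf-allBits-⊕ b i _ (λ w → G (v ∷ w))) ⟩
    ∑[ v ∈ BB ] ∑[ w ∈ allVecsOf BB i ] G (v ∷ w)    ≡⟨ ∑-allVecsOf-suc BB i G ⟨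
    ∑ (allVecsOf BB (suc i)) G                       ∎

∑-∏-simpleTab : {A : Set} {k m b i : ℕ} (h : A → Vec (Bits k) m) (f : A → Bits b → ℕ) (t : Vec A i) →
                Independent (Vec.map (λ x → h x ∷ []) t) →
                (2 ^ b) ^ i * ∑[ T ∈ allTables k m b ] ∏ (Vec.map (λ x → f x (simpleTab T (h x))) t)
                  ≡ length (allTables k m b) * ∏ (Vec.map (λ x → ∑ (allBits b) (f x)) t)
∑-∏-simpleTab {A} {k} {m} {b} {i} h f t indep = begin
  (2 ^ b) ^ i * ∑[ T ∈ TT ] ∏ (Vec.map (λ x → f x (simpleTab T (h x))) t)
                                                        ≡⟨ cong ((2 ^ b) ^ i *_) (∑-cong TT λ T → cong ∏ (⊛-evals T t)) ⟨
  (2 ^ b) ^ i * ∑[ T ∈ TT ] ∏ (Vec.map f t ⊛ evals T Fs)  ≡⟨ evals-uniform Fs indep _ ⟩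
  length TT * ∑[ w ∈ allVecsOf (allBits b) i ] ∏ (Vec.map f t ⊛ w)
                                                        ≡⟨ cong (length TT *_) (∑-allVecsOf-∏ (allBits b) (Vec.map f t)) ⟩
  length TT * ∏ (Vec.map (∑ (allBits b)) (Vec.map f t))   ≡⟨ cong (λ v → length TT * ∏ v) (VecP.map-∘ (∑ (allBits b)) f t) ⟨
  length TT * ∏ (Vec.map (λ x → ∑ (allBits b) (f x)) t)   ∎
  where
  open ≡-Reasoning
  TT : List (Tables k m b)
  TT = allTables k m b
  Fs : Vec (Form k m) i
  Fs = Vec.map (λ x → h x ∷ []) t
  ⊛-evals : ∀ T {n} (t : Vec A n) → (Vec.map f t ⊛ evals T (Vec.map (λ x → h x ∷ []) t))
                                     ≡ Vec.map (λ x → f x (simpleTab T (h x))) t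
  ⊛-evals T []      = refl
  ⊛-evals T (x ∷ t) = cong₂ _∷_ (cong (f x) (⊕-identityʳ _)) (⊛-evals T t)

single-independent : {k m : ℕ} (y : Vec (Bits k) (suc m)) → Independent ((y ∷ []) ∷ [])
single-independent y (false ∷ []) _    = refl
single-independent y (true ∷ [])  even with lookup y zero == lookup y zero in eq | even zero (lookup y zero)
... | true  | ()
... | false | _ = contradiction (trans (sym eq) (==-refl (lookup y zero))) λ ()
  where
  ==-refl : {n : ℕ} (u : Bits n) → (u == u) ≡ true
  ==-refl u with VecP.≡-dec _≟B_ u u
  ... | yes _   = refl
  ... | no u≢u  = contradiction refl u≢u

-- Linear independence

subfamilies-skip : {A : Set} (a : A) (L : List A) {Y : List A} → Y ∈ subfamilies L → Y ∈ subfamilies (a ∷ L)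
subfamilies-skip a L Y∈ = ∈-concatMap⁺ _ (lose Y∈ (here refl))

subfamilies-keep : {A : Set} (a : A) (L : List A) {Y : List A} → Y ∈ subfamilies L → a ∷ Y ∈ subfamilies (a ∷ L)
subfamilies-keep a L Y∈ = ∈-concatMap⁺ _ (lose Y∈ (there (here refl)))

subfamilies-∷⁻ : {A : Set} {a : A} (L : List A) {Y : List A} → Y ∈ subfamilies (a ∷ L) →
                 Σ (List A) λ Y′ → Y′ ∈ subfamilies L × (Y ≡ Y′ ⊎ Y ≡ a ∷ Y′)
subfamilies-∷⁻ L Y∈ with find (∈-concatMap⁻ _ {xs = subfamilies L} Y∈)
... | Y′ , Y′∈ , here Y≡Y′           = Y′ , Y′∈ , inj₁ Y≡Y′
... | Y′ , Y′∈ , there (here Y≡aY′)  = Y′ , Y′∈ , inj₂ Y≡aY′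

filter-∈-subfamilies : {A : Set} (p : A → Bool) (L : List A) → filter (λ x → T? (p x)) L ∈ subfamilies L
filter-∈-subfamilies p []      = here refl
filter-∈-subfamilies p (a ∷ L) with p a
... | true  = subfamilies-keep a L (filter-∈-subfamilies p L)
... | false = subfamilies-skip a L (filter-∈-subfamilies p L)

map-∈-subfamilies : {A B : Set} (f : A → B) (L : List A) {Y : List A} → Y ∈ subfamilies L → map f Y ∈ subfamilies (map f L)
map-∈-subfamilies f []      (here refl) = here refl
map-∈-subfamilies f (a ∷ L) Y∈ with subfamilies-∷⁻ L Y∈
... | Y′ , Y′∈ , inj₁ refl = subfamilies-skip (f a) (map f L) (map-∈-subfamilies f L Y′∈)
... | Y′ , Y′∈ , inj₂ refl = subfamilies-keep (f a) (map f L) (map-∈-subfamilies f L Y′∈)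

select-∈-subfamilies : {A : Set} {i : ℕ} (mask : Vec Bool i) (t : Vec A i) → select mask t ∈ subfamilies (toList t)
select-∈-subfamilies []             []      = here refl
select-∈-subfamilies (true  ∷ mask) (a ∷ t) = subfamilies-keep a (toList t) (select-∈-subfamilies mask t)
select-∈-subfamilies (false ∷ mask) (a ∷ t) = subfamilies-skip a (toList t) (select-∈-subfamilies mask t)

IsDependency : {k m : ℕ} → Form k m → Bool
IsDependency Y = nonempty Y ∧ allEven Y

no-dependency : {k m : ℕ} (F : Form k m) {Y : Form k m} → linIndependent F ≡ true → Y ∈ subfamilies F → IsDependency Y ≡ true → ⊥
no-dependency F indep Y∈ dep = T-not (any⁺ IsDependency (lose Y∈ (subst T (sym dep) tt))) indep
  where
  T-not : {b : Bool} → T b → not b ≡ true → ⊥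
  T-not {true} _ ()

some-dependency : {k m : ℕ} (F : Form k m) → linIndependent F ≡ false →
                  Σ (Form k m) λ Y → Y ∈ subfamilies F × IsDependency Y ≡ true
some-dependency F dependent with find (any⁻ IsDependency (subfamilies F) (subst T (sym (not-false dependent)) tt))
  where
  not-false : {b : Bool} → not b ≡ false → b ≡ true
  not-false {true} _ = refl
... | Y , Y∈ , dep = Y , Y∈ , T⇒≡true dep
  where
  T⇒≡true : {b : Bool} → T b → b ≡ true
  T⇒≡true {true} _ = refl

isEven-suc : ∀ n → isEven (suc n) ≡ not (isEven n)
isEven-suc zero          = refl
isEven-suc (suc zero)    = refl
isEven-suc (suc (suc n)) = isEven-suc n

isEven-count : {k m : ℕ} (j : Fin m) (a : Bits k) (Y : Form k m) →
               isEven (count (λ y → lookup y j == a) Y) ≡ not (parity j a Y)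
isEven-count j a []      = refl
isEven-count j a (y ∷ Y) with lookup y j == a
... | true  = trans (isEven-suc (count _ Y)) (cong not (isEven-count j a Y))
... | false = isEven-count j a Y

all-true : {A : Set} (p : A → Bool) (L : List A) → (∀ x → p x ≡ true) → all p L ≡ true
all-true p []      p≡true = refl
all-true p (y ∷ L) p≡true rewrite p≡true y = all-true p L p≡true

all-cong : {A : Set} {p q : A → Bool} (L : List A) → (∀ x → p x ≡ q x) → all p L ≡ all q L
all-cong []      p≗q = refl
all-cong (y ∷ L) p≗q = cong₂ _∧_ (p≗q y) (all-cong L p≗q)

allEven-parity : {k m : ℕ} (Y : Form k m) → (∀ j a → parity j a Y ≡ false) → allEven Y ≡ true
allEven-parity {k} {m} Y even =
  all-true _ (allFin m) λ j → all-true _ (allBits k) λ a → trans (isEven-count j a Y) (cong not (even j a))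

allEven-count-cong : {k m : ℕ} (Y Y′ : Form k m) → (∀ p → count p Y ≡ count p Y′) → allEven Y ≡ allEven Y′
allEven-count-cong {k} {m} Y Y′ same-counts =
  all-cong (allFin m) λ j → all-cong (allBits k) λ a → cong isEven (same-counts (λ y → lookup y j == a))

combine-singletons : {A : Set} {k m i : ℕ} (h : A → Vec (Bits k) m) (mask : Vec Bool i) (t : Vec A i) →
                     combine mask (Vec.map (λ x → h x ∷ []) t) ≡ map h (select mask t)
combine-singletons h []             []      = refl
combine-singletons h (true  ∷ mask) (a ∷ t) = cong (h a ∷_) (combine-singletons h mask t)
combine-singletons h (false ∷ mask) (a ∷ t) = combine-singletons h mask t

select-empty : {A : Set} {i : ℕ} (mask : Vec Bool i) (t : Vec A i) → nonempty (select mask t) ≡ false → mask ≡ replicate i false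
select-empty []             []      _     = refl
select-empty (false ∷ mask) (a ∷ t) empty = cong (false ∷_) (select-empty mask t empty)

nonempty-map : {A B : Set} (f : A → B) (L : List A) → nonempty (map f L) ≡ nonempty L
nonempty-map f []      = refl
nonempty-map f (_ ∷ _) = refl

linIndependent⇒Independent : {A : Set} {k m i : ℕ} (h : A → Vec (Bits k) m) (t : Vec A i) →
                             linIndependent (map h (toList t)) ≡ true → Independent (Vec.map (λ x → h x ∷ []) t)
linIndependent⇒Independent h t indep mask even with nonempty (select mask t) in selected
... | false = select-empty mask t selected
... | true  = ⊥-elim (no-dependency (map h (toList t)) indep (map-∈-subfamilies h (toList t) (select-∈-subfamilies mask t))
                        (cong₂ _∧_ (trans (nonempty-map h (select mask t)) selected)
                                   (allEven-parity (map h (select mask t)) λ j a → trans (cong (parity j a) (sym (combine-singletons h mask t))) (even j a))))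

lookup-∷ʳ-inject₁ : {A : Set} {m : ℕ} (y : Vec A m) (a : A) (j : Fin m) → lookup (y ∷ʳ a) (inject₁ j) ≡ lookup y j
lookup-∷ʳ-inject₁ (x ∷ y) a zero    = refl
lookup-∷ʳ-inject₁ (x ∷ y) a (suc j) = lookup-∷ʳ-inject₁ y a j

parity-∷ʳ : {k m : ℕ} (j : Fin m) (b a : Bits k) (Y : Form k m) → parity (inject₁ j) b (map (_∷ʳ a) Y) ≡ parity j b Y
parity-∷ʳ j b a []      = refl
parity-∷ʳ j b a (y ∷ Y) = cong₂ _xor_ (cong (_== b) (lookup-∷ʳ-inject₁ y a j)) (parity-∷ʳ j b a Y)

Independent-∷ʳ : {A : Set} {k m i : ℕ} (h : A → Vec (Bits k) m) (a : Bits k) (t : Vec A i) →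
                 Independent (Vec.map (λ x → h x ∷ []) t) → Independent (Vec.map (λ x → (h x ∷ʳ a) ∷ []) t)
Independent-∷ʳ h a t indep mask even = indep mask λ j b → begin
  parity j b (combine mask (Vec.map (λ x → h x ∷ []) t))      ≡⟨ cong (parity j b) (combine-singletons h mask t) ⟩
  parity j b (map h (select mask t))                          ≡⟨ parity-∷ʳ j b a (map h (select mask t)) ⟨
  parity (inject₁ j) b (map (_∷ʳ a) (map h (select mask t)))  ≡⟨ cong (parity (inject₁ j) b) (map-∘ {g = _∷ʳ a} {f = h} (select mask t)) ⟨
  parity (inject₁ j) b (map (λ x → h x ∷ʳ a) (select mask t)) ≡⟨ cong (parity (inject₁ j) b) (combine-singletons (λ x → h x ∷ʳ a) mask t) ⟨
  parity (inject₁ j) b (combine mask (Vec.map (λ x → (h x ∷ʳ a) ∷ []) t)) ≡⟨ even (inject₁ j) b ⟩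
  false                                                       ∎
  where open ≡-Reasoning

m≤n≤1⇒m*n≡m : {m n : ℕ} → m ≤ n → n ≤ 1 → m * n ≡ m
m≤n≤1⇒m*n≡m z≤n             _   = refl
m≤n≤1⇒m*n≡m (s≤s z≤n) (s≤s z≤n) = refl

nonempty-length : {A : Set} {L M : List A} → length L ≡ length M → nonempty L ≡ nonempty M
nonempty-length {L = []}    {[]}    _ = refl
nonempty-length {L = _ ∷ _} {_ ∷ _} _ = refl

module _ {A : Set} (_≟_ : DecidableEquality A) where
  open Multiplicity _≟_

  subfamilies-map⁻ : {B : Set} (pre : A → B) (L : List A) {Y : List B} → Y ∈ subfamilies (map pre L) →
                     Σ (List A) λ L′ → Y ≡ map pre L′ × (∀ β → mult β L′ ≤ mult β L)
  subfamilies-map⁻ pre []      (here refl) = [] , refl , λ β → z≤n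
  subfamilies-map⁻ pre (a ∷ L) Y∈ with subfamilies-∷⁻ (map pre L) Y∈
  ... | Y′ , Y′∈ , inj₁ refl with subfamilies-map⁻ pre L Y′∈
  ...   | L′ , refl , L′⊆L = L′ , refl , λ β → ≤-trans (L′⊆L β) (m≤n+m _ _)
  subfamilies-map⁻ pre (a ∷ L) Y∈ | Y′ , Y′∈ , inj₂ refl with subfamilies-map⁻ pre L Y′∈
  ...   | L′ , refl , L′⊆L = a ∷ L′ , refl , λ β → +-monoʳ-≤ (𝟙 ⌊ a ≟ β ⌋) (L′⊆L β)

  memberᵇ : A → List A → Bool
  memberᵇ x L = not (mult x L ≡ᵇ 0)

  𝟙-memberᵇ : (x : A) (L : List A) → mult x L ≤ 1 → 𝟙 (memberᵇ x L) ≡ mult x L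
  𝟙-memberᵇ x L ≤1 with mult x L | ≤1
  ... | zero  | _       = refl
  ... | suc _ | s≤s z≤n = refl

  -- Selecting the members of L′ from Xs recovers L′ up to order.
  ∑-filter-memberᵇ : (U : List A) → Enumeration U → (L′ Xs : List A) → (∀ β → mult β L′ ≤ mult β Xs) → AtMostOnce Xs →
                     (g : A → ℕ) → ∑ (filter (λ x → T? (memberᵇ x L′)) Xs) g ≡ ∑ L′ g
  ∑-filter-memberᵇ U enum L′ Xs L′⊆Xs once g = begin
    ∑ (filter (λ x → T? (memberᵇ x L′)) Xs) g      ≡⟨ ∑-filter (λ x → memberᵇ x L′) Xs g ⟩
    ∑[ x ∈ Xs ] (𝟙 (memberᵇ x L′) * g x)           ≡⟨ ∑-cong Xs (λ x → cong (_* g x) (𝟙-memberᵇ x L′ (≤-trans (L′⊆Xs x) (once x)))) ⟩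
    ∑[ x ∈ Xs ] (mult x L′ * g x)                  ≡⟨ ∑-mult-swap Xs L′ g ⟩
    ∑[ y ∈ L′ ] (mult y Xs * g y)                  ≡⟨ ∑-mult-enumeration U enum L′ _ ⟨
    ∑[ y ∈ U ] (mult y L′ * (mult y Xs * g y))     ≡⟨ ∑-cong U (λ y → trans (sym (*-assoc (mult y L′) _ (g y)))
                                                        (cong (_* g y) (m≤n≤1⇒m*n≡m (L′⊆Xs y) (once y)))) ⟩
    ∑[ y ∈ U ] (mult y L′ * g y)                   ≡⟨ ∑-mult-enumeration U enum L′ g ⟩
    ∑ L′ g                                         ∎
    where open ≡-Reasoning

  linIndependent-⊆ : (U : List A) → Enumeration U → {k m : ℕ} (pre : A → Vec (Bits k) m) {L Xs : List A} →
                     (∀ β → mult β L ≤ mult β Xs) → AtMostOnce Xs →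
                     linIndependent (map pre Xs) ≡ true → linIndependent (map pre L) ≡ true
  linIndependent-⊆ U enum pre {L} {Xs} L⊆Xs once indep with linIndependent (map pre L) in eq
  ... | true  = refl
  ... | false with some-dependency (map pre L) eq
  ...   | Y , Y∈ , dep with subfamilies-map⁻ pre L Y∈
  ...     | L′ , refl , L′⊆L = ⊥-elim (no-dependency (map pre Xs) indep
                                       (map-∈-subfamilies pre Xs (filter-∈-subfamilies _ Xs)) dependency)
    where
    M : List A
    M = filter (λ x → T? (memberᵇ x L′)) Xs
    same : ∀ g → ∑ M g ≡ ∑ L′ g
    same = ∑-filter-memberᵇ U enum L′ Xs (λ β → ≤-trans (L′⊆L β) (L⊆Xs β)) once
    same-counts : ∀ p → count p (map pre M) ≡ count p (map pre L′)
    same-counts p = begin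
      count p (map pre M)          ≡⟨ count≡∑𝟙 p (map pre M) ⟩
      ∑ (map pre M) (𝟙 ∘ p)        ≡⟨ ∑-map pre M _ ⟩
      ∑[ x ∈ M ] 𝟙 (p (pre x))     ≡⟨ same _ ⟩
      ∑[ x ∈ L′ ] 𝟙 (p (pre x))    ≡⟨ ∑-map pre L′ _ ⟨
      ∑ (map pre L′) (𝟙 ∘ p)       ≡⟨ count≡∑𝟙 p (map pre L′) ⟨
      count p (map pre L′)         ∎
      where open ≡-Reasoning
    same-length : length (map pre M) ≡ length (map pre L′)
    same-length = begin
      length (map pre M)           ≡⟨ length≡∑1 (map pre M) ⟩
      ∑[ _ ∈ map pre M ] 1         ≡⟨ trans (∑-map pre M _) (trans (same _) (sym (∑-map pre L′ _))) ⟩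
      ∑[ _ ∈ map pre L′ ] 1        ≡⟨ length≡∑1 (map pre L′) ⟨
      length (map pre L′)          ∎
      where open ≡-Reasoning
    dependency : IsDependency (map pre M) ≡ true
    dependency = trans (cong₂ _∧_ (nonempty-length same-length) (allEven-count-cong (map pre M) (map pre L′) same-counts)) dep

-- A tornado function is assembled from a context, the table T of the last derived
-- character and the table T̂ of ĥ.  For d ≥ 1 the context holds the tables of
-- h₀, h̃₁ … h̃_{d-1} and T is that of h̃_d.  For d = 0 the context is trivial, T is
-- the table of h₀, and x̃_c = x_c ⊕ h₀(x₁ … x_{c-1}) carries the offset x_c.
record LastCharacterSplit (k r c₀ d : ℕ) : Set₁ where
  field
    Context  : Set
    contexts : List Context
    prefix   : Context → Vec (Bits k) (suc c₀) → Vec (Bits k) (d + c₀)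
    offset   : Context → Vec (Bits k) (suc c₀) → Bits k
    assemble : Context → Tables k (d + c₀) k → Tables k (suc (d + c₀)) r → Tornado k r c₀ d
    ∑-allTornado  : ∀ Ψ → ∑ (allTornado k r c₀ d) Ψ
                          ≡ ∑[ ρ ∈ contexts ] ∑[ T ∈ allTables k (d + c₀) k ] ∑[ T̂ ∈ allTables k (suc (d + c₀)) r ] Ψ (assemble ρ T T̂)
    init-derived  : ∀ ρ T T̂ x → init (derived (assemble ρ T T̂) x) ≡ prefix ρ x
    last-derived  : ∀ ρ T T̂ x → last (derived (assemble ρ T T̂) x) ≡ offset ρ x ⊕ simpleTab T (prefix ρ x)
    T̂-assemble    : ∀ ρ T T̂ → Tornado.T̂ (assemble ρ T T̂) ≡ T̂

∑-allTornado-tables : (k r c₀ d : ℕ) (Ψ : Tornado k r c₀ d → ℕ) →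
  ∑ (allTornado k r c₀ d) Ψ
    ≡ ∑[ t₀ ∈ allTables k c₀ k ] ∑[ t̃ ∈ allDerivedTables k c₀ d ] ∑[ t̂ ∈ allTables k (suc (d + c₀)) r ]
        Ψ (record { T₀ = t₀ ; T̃ = t̃ ; T̂ = t̂ })
∑-allTornado-tables k r c₀ d Ψ =
  trans (∑-concatMap _ (allTables k c₀ k) Ψ)
        (∑-cong (allTables k c₀ k) λ t₀ → ∑-concatMap-map (allDerivedTables k c₀ d) _ _ Ψ)

lastCharacterSplit : (k r c₀ d : ℕ) → LastCharacterSplit k r c₀ d
lastCharacterSplit k r c₀ zero = record
  { Context       = ⊤
  ; contexts      = tt ∷ []
  ; prefix        = λ _ x → init x
  ; offset        = λ _ x → last x
  ; assemble      = λ _ T T̂ → record { T₀ = T ; T̃ = tt ; T̂ = T̂ }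
  ; ∑-allTornado  = λ Ψ → trans (∑-allTornado-tables k r c₀ zero Ψ)
                      (trans (∑-cong (allTables k c₀ k) λ _ → +-identityʳ _) (sym (+-identityʳ _)))
  ; init-derived  = λ _ _ _ x → VecP.init-∷ʳ _ (init x)
  ; last-derived  = λ _ _ _ x → VecP.last-∷ʳ _ (init x)
  ; T̂-assemble    = λ _ _ _ → refl
  }
lastCharacterSplit k r c₀ (suc d) = record
  { Context       = Tables k c₀ k × DerivedTables k c₀ d
  ; contexts      = concatMap (λ t₀ → map (t₀ ,_) (allDerivedTables k c₀ d)) (allTables k c₀ k)
  ; prefix        = λ (t₀ , ts) x → derivedWith d t₀ ts x
  ; offset        = λ _ _ → 𝟎
  ; assemble      = λ (t₀ , ts) T T̂ → record { T₀ = t₀ ; T̃ = ts , T ; T̂ = T̂ }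
  ; ∑-allTornado  = λ Ψ → trans (∑-allTornado-tables k r c₀ (suc d) Ψ)
                      (trans (∑-cong (allTables k c₀ k) λ t₀ → ∑-concatMap-map (allDerivedTables k c₀ d) _ _ _)
                             (sym (∑-concatMap-map (allTables k c₀ k) _ _ _)))
  ; init-derived  = λ (t₀ , ts) _ _ x → VecP.init-∷ʳ _ (derivedWith d t₀ ts x)
  ; last-derived  = λ (t₀ , ts) _ _ x → trans (VecP.last-∷ʳ _ (derivedWith d t₀ ts x)) (sym (⊕-identityˡ _))
  ; T̂-assemble    = λ _ _ _ → refl
  }

-- The tail bound

^-distribʳ-* : ∀ a b n → (a * b) ^ n ≡ a ^ n * b ^ n
^-distribʳ-* a b zero    = refl
^-distribʳ-* a b (suc n) = trans (cong (a * b *_) (^-distribʳ-* a b n)) (*-interchange a b (a ^ n) (b ^ n))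
  where open CommSemigroupProperties *-commutativeSemigroup renaming (interchange to *-interchange)

𝟙-all-∧ : {A : Set} {i : ℕ} (p q′ q : A → Bool) → (∀ x → p x ≡ true → q′ x ≡ q x) → (t : Vec A i) →
          𝟙 (all (λ x → p x ∧ q′ x) (toList t)) ≡ ∏ (Vec.map (𝟙 ∘ p) t) * ∏ (Vec.map (𝟙 ∘ q) t)
𝟙-all-∧ p q′ q q′≡q []      = refl
𝟙-all-∧ p q′ q q′≡q (a ∷ t) = begin
  𝟙 ((p a ∧ q′ a) ∧ all (λ x → p x ∧ q′ x) (toList t))          ≡⟨ 𝟙-∧ (p a ∧ q′ a) _ ⟩
  𝟙 (p a ∧ q′ a) * 𝟙 (all (λ x → p x ∧ q′ x) (toList t))        ≡⟨ cong₂ _*_ (trans (𝟙-∧ (p a) (q′ a)) (head (p a) refl)) (𝟙-all-∧ p q′ q q′≡q t) ⟩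
  (𝟙 (p a) * 𝟙 (q a)) * (∏ (Vec.map (𝟙 ∘ p) t) * ∏ (Vec.map (𝟙 ∘ q) t)) ≡⟨ *-interchange (𝟙 (p a)) _ _ _ ⟩
  (𝟙 (p a) * ∏ (Vec.map (𝟙 ∘ p) t)) * (𝟙 (q a) * ∏ (Vec.map (𝟙 ∘ q) t)) ∎
  where
  open ≡-Reasoning
  open CommSemigroupProperties *-commutativeSemigroup renaming (interchange to *-interchange)
  head : ∀ b → p a ≡ b → 𝟙 b * 𝟙 (q′ a) ≡ 𝟙 b * 𝟙 (q a)
  head true  pa = cong (λ c → 𝟙 c + 0) (q′≡q a pa)
  head false _  = refl

∏-map-1 : {A : Set} {i : ℕ} (g : A → ℕ) → (∀ x → g x ≡ 1) → (t : Vec A i) → ∏ (Vec.map g t) ≡ 1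
∏-map-1 g g≡1 []      = refl
∏-map-1 g g≡1 (a ∷ t) rewrite g≡1 a | ∏-map-1 g g≡1 t = refl

module TailBound (k r c₀ d : ℕ) (φ : Vec (Bits k) (suc c₀) → Bits r → Bool) (α : Bits k) where
  open LastCharacterSplit (lastCharacterSplit k r c₀ d)

  Key : Set
  Key = Vec (Bits k) (suc c₀)

  _≟K_ : DecidableEquality Key
  _≟K_ = VecP.≡-dec (VecP.≡-dec _≟B_)

  open Multiplicity _≟K_

  keys : List Key
  keys = allKeys k (suc c₀)

  keys-enumeration : Enumeration keys
  keys-enumeration = allKeys-enumeration k (suc c₀)

  tornados : List (Tornado k r c₀ d)
  tornados = allTornado k r c₀ d

  Ts : List (Tables k (d + c₀) k)
  Ts = allTables k (d + c₀) k

  T̂s : List (Tables k (suc (d + c₀)) r)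
  T̂s = allTables k (suc (d + c₀)) r

  Ω : ℕ
  Ω = #Ω k r c₀ d

  count-tornados : Ω ≡ length contexts * (length Ts * length T̂s)
  count-tornados = begin
    length tornados                                  ≡⟨ length≡∑1 tornados ⟩
    ∑[ _ ∈ tornados ] 1                              ≡⟨ ∑-allTornado (λ _ → 1) ⟩
    ∑[ ρ ∈ contexts ] ∑[ T ∈ Ts ] ∑[ _ ∈ T̂s ] 1      ≡⟨ ∑-cong contexts (λ ρ → ∑-cong Ts (λ T → sym (length≡∑1 T̂s))) ⟩
    ∑[ ρ ∈ contexts ] ∑[ T ∈ Ts ] length T̂s          ≡⟨ ∑-cong contexts (λ ρ → ∑-const Ts _) ⟩
    ∑[ ρ ∈ contexts ] (length Ts * length T̂s)        ≡⟨ ∑-const contexts _ ⟩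
    length contexts * (length Ts * length T̂s)        ∎
    where open ≡-Reasoning

  ∑-tornados-const : (c : ℕ) → ∑[ ρ ∈ contexts ] ∑[ T ∈ Ts ] (length T̂s * c) ≡ Ω * c
  ∑-tornados-const c = begin
    ∑[ ρ ∈ contexts ] ∑[ T ∈ Ts ] (length T̂s * c)       ≡⟨ ∑-cong contexts (λ ρ → ∑-const Ts _) ⟩
    ∑[ ρ ∈ contexts ] (length Ts * (length T̂s * c))      ≡⟨ ∑-const contexts _ ⟩
    length contexts * (length Ts * (length T̂s * c))      ≡⟨ cong (length contexts *_) (*-assoc (length Ts) _ c) ⟨
    length contexts * (length Ts * length T̂s * c)        ≡⟨ *-assoc (length contexts) _ c ⟨
    length contexts * (length Ts * length T̂s) * c        ≡⟨ cong (_* c) count-tornados ⟨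
    Ω * c                                                 ∎
    where open ≡-Reasoning

  lastChar : Context → Tables k (d + c₀) k → Key → Bits k
  lastChar ρ T x = offset ρ x ⊕ simpleTab T (prefix ρ x)

  hash-assemble : ∀ ρ T T̂ x → hash (assemble ρ T T̂) x ≡ simpleTab T̂ (prefix ρ x ∷ʳ lastChar ρ T x)
  hash-assemble ρ T T̂ x = cong₂ simpleTab (T̂-assemble ρ T T̂)
    (trans (proj₂ (proj₂ (Vec.initLast (derived (assemble ρ T T̂) x))))
           (cong₂ _∷ʳ_ (init-derived ρ T T̂ x) (last-derived ρ T T̂ x)))

  q : Key → ℕ
  q x = ∑[ u ∈ allBits r ] 𝟙 (φ x u)

  Q : ℕ
  Q = ∑ keys q

  hash-uniform : ∀ x → ∑[ H ∈ tornados ] 𝟙 (φ x (hash H x)) * 2 ^ r ≡ Ω * q x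
  hash-uniform x = begin
    ∑[ H ∈ tornados ] 𝟙 (φ x (hash H x)) * 2 ^ r                                         ≡⟨ cong (_* 2 ^ r) (∑-allTornado _) ⟩
    ∑[ ρ ∈ contexts ] ∑[ T ∈ Ts ] ∑[ T̂ ∈ T̂s ] 𝟙 (φ x (hash (assemble ρ T T̂) x)) * 2 ^ r  ≡⟨ *-distribʳ-∑ _ contexts _ ⟩
    ∑[ ρ ∈ contexts ] (∑[ T ∈ Ts ] ∑[ T̂ ∈ T̂s ] 𝟙 (φ x (hash (assemble ρ T T̂) x)) * 2 ^ r) ≡⟨ ∑-cong contexts (λ ρ → *-distribʳ-∑ _ Ts _) ⟩
    ∑[ ρ ∈ contexts ] ∑[ T ∈ Ts ] (∑[ T̂ ∈ T̂s ] 𝟙 (φ x (hash (assemble ρ T T̂) x)) * 2 ^ r) ≡⟨ ∑-cong contexts (λ ρ → ∑-cong Ts (per-table ρ)) ⟩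
    ∑[ ρ ∈ contexts ] ∑[ T ∈ Ts ] (length T̂s * q x)                                     ≡⟨ ∑-tornados-const (q x) ⟩
    Ω * q x                                                                              ∎
    where
    open ≡-Reasoning
    per-table : ∀ ρ T → ∑[ T̂ ∈ T̂s ] 𝟙 (φ x (hash (assemble ρ T T̂) x)) * 2 ^ r ≡ length T̂s * q x
    per-table ρ T = begin
      ∑[ T̂ ∈ T̂s ] 𝟙 (φ x (hash (assemble ρ T T̂) x)) * 2 ^ r         ≡⟨ *-comm _ (2 ^ r) ⟩
      2 ^ r * ∑[ T̂ ∈ T̂s ] 𝟙 (φ x (hash (assemble ρ T T̂) x))         ≡⟨ cong₂ _*_ (*-identityʳ (2 ^ r)) (∑-cong T̂s λ T̂ → trans (*-identityʳ _) (cong (𝟙 ∘ φ x) (sym (hash-assemble ρ T T̂ x)))) ⟨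
      (2 ^ r) ^ 1 * ∑[ T̂ ∈ T̂s ] ∏ (Vec.map (λ x → 𝟙 (φ x (simpleTab T̂ (y x)))) (x ∷ [])) ≡⟨ ∑-∏-simpleTab y (λ x u → 𝟙 (φ x u)) (x ∷ []) (single-independent (y x)) ⟩
      length T̂s * (q x * 1)                                          ≡⟨ cong (length T̂s *_) (*-identityʳ (q x)) ⟩
      length T̂s * q x                                                ∎
      where
      y : Key → Vec (Bits k) (suc (d + c₀))
      y x = prefix ρ x ∷ʳ lastChar ρ T x

  expected-size : ΣX {k} {r} {c₀} {d} φ * 2 ^ r ≡ Ω * Q
  expected-size = begin
    ∑[ H ∈ tornados ] length (Xset φ H) * 2 ^ r                  ≡⟨ cong (_* 2 ^ r) (∑-cong tornados (λ H → count≡∑𝟙 _ keys)) ⟩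
    ∑[ H ∈ tornados ] ∑[ x ∈ keys ] 𝟙 (φ x (hash H x)) * 2 ^ r   ≡⟨ cong (_* 2 ^ r) (∑-comm tornados keys _) ⟩
    ∑[ x ∈ keys ] ∑[ H ∈ tornados ] 𝟙 (φ x (hash H x)) * 2 ^ r   ≡⟨ *-distribʳ-∑ _ keys _ ⟩
    ∑[ x ∈ keys ] (∑[ H ∈ tornados ] 𝟙 (φ x (hash H x)) * 2 ^ r) ≡⟨ ∑-cong keys hash-uniform ⟩
    ∑[ x ∈ keys ] (Ω * q x)                                      ≡⟨ *-distribˡ-∑ Ω keys q ⟨
    Ω * Q                                                        ∎
    where open ≡-Reasoning

  inXα : Tornado k r c₀ d → Key → Bool
  inXα H x = (last (derived H x) == α) ∧ φ x (hash H x)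

  good : {i : ℕ} → Tornado k r c₀ d → Vec Key i → ℕ
  good H t = 𝟙 (linIndependent (map (λ x → init (derived H x)) (toList t)) ∧ all (inXα H) (toList t))

  good-assemble : ∀ {i} ρ T T̂ (t : Vec Key i) → good (assemble ρ T T̂) t ≡
    𝟙 (linIndependent (map (prefix ρ) (toList t))
       ∧ all (λ x → (lastChar ρ T x == α) ∧ φ x (simpleTab T̂ (prefix ρ x ∷ʳ lastChar ρ T x))) (toList t))
  good-assemble ρ T T̂ t = cong 𝟙 (cong₂ _∧_
    (cong linIndependent (map-cong (init-derived ρ T T̂) (toList t)))
    (all-cong (toList t) λ x → cong₂ _∧_ (cong (_== α) (last-derived ρ T T̂ x)) (cong (φ x) (hash-assemble ρ T T̂ x))))

  -- Given the context, the last characters are uniform and independent, and once they all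
  -- equal α the full derived keys prefix·α are independent, so their hash values are too.
  good-context : ∀ {i} ρ (t : Vec Key i) →
    ∑[ T ∈ Ts ] ∑[ T̂ ∈ T̂s ] good (assemble ρ T T̂) t * ((2 ^ k) ^ i * (2 ^ r) ^ i) ≤ length Ts * (length T̂s * ∏ (Vec.map q t))
  good-context {i} ρ t with linIndependent (map (prefix ρ) (toList t)) in indep
  ... | false = begin
    ∑[ T ∈ Ts ] ∑[ T̂ ∈ T̂s ] good (assemble ρ T T̂) t * K    ≡⟨ cong (_* K) (trans (∑-cong Ts λ T → trans (∑-cong T̂s (vanishes T)) (∑-zero T̂s)) (∑-zero Ts)) ⟩
    0                                                      ≤⟨ z≤n ⟩
    length Ts * (length T̂s * ∏ (Vec.map q t))              ∎
    where
    open ≤-Reasoning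
    K : ℕ
    K = (2 ^ k) ^ i * (2 ^ r) ^ i
    vanishes : ∀ T T̂ → good (assemble ρ T T̂) t ≡ 0
    vanishes T T̂ = trans (good-assemble ρ T T̂ t) (cong 𝟙 (false-∧ _ indep))
  ... | true = ≤-reflexive (begin
    ∑[ T ∈ Ts ] ∑[ T̂ ∈ T̂s ] good (assemble ρ T T̂) t * K      ≡⟨ cong (_* K) (∑-cong Ts λ T → trans (∑-cong T̂s (factor T)) (sym (*-distribˡ-∑ (lastα T) T̂s selected))) ⟩
    ∑[ T ∈ Ts ] (lastα T * ∑ T̂s selected) * K                           ≡⟨ cong (_* K) (*-distribʳ-∑ (∑ T̂s selected) Ts lastα) ⟨
    (∑ Ts lastα * ∑ T̂s selected) * ((2 ^ k) ^ i * (2 ^ r) ^ i)          ≡⟨ *-interchange (∑ Ts lastα) (∑ T̂s selected) _ _ ⟩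
    (∑ Ts lastα * (2 ^ k) ^ i) * (∑ T̂s selected * (2 ^ r) ^ i)          ≡⟨ cong₂ _*_ (trans (*-comm (∑ Ts lastα) _) uniform-last) (trans (*-comm (∑ T̂s selected) _) uniform-hash) ⟩
    length Ts * (length T̂s * ∏ (Vec.map q t))               ∎)
    where
    open ≡-Reasoning
    open CommSemigroupProperties *-commutativeSemigroup renaming (interchange to *-interchange)
    K : ℕ
    K = (2 ^ k) ^ i * (2 ^ r) ^ i
    lastα : Tables k (d + c₀) k → ℕ
    lastα T = ∏ (Vec.map (λ x → 𝟙 (lastChar ρ T x == α)) t)
    selected : Tables k (suc (d + c₀)) r → ℕ
    selected T̂ = ∏ (Vec.map (λ x → 𝟙 (φ x (simpleTab T̂ (prefix ρ x ∷ʳ α)))) t)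
    factor : ∀ T T̂ → good (assemble ρ T T̂) t ≡ lastα T * selected T̂
    factor T T̂ = trans (good-assemble ρ T T̂ t) (trans (cong 𝟙 (true-∧ _ indep))
      (𝟙-all-∧ (λ x → lastChar ρ T x == α) _ (λ x → φ x (simpleTab T̂ (prefix ρ x ∷ʳ α)))
               (λ x last≡α → cong (λ c → φ x (simpleTab T̂ (prefix ρ x ∷ʳ c))) (==⇒≡ last≡α)) t))
      where
      ==⇒≡ : {n : ℕ} {u v : Bits n} → (u == v) ≡ true → u ≡ v
      ==⇒≡ {u = u} {v} u==v with VecP.≡-dec _≟B_ u v
      ... | yes u≡v = u≡v
    prefixes-independent : Independent (Vec.map (λ x → prefix ρ x ∷ []) t)
    prefixes-independent = linIndependent⇒Independent (prefix ρ) t indep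
    uniform-last : (2 ^ k) ^ i * ∑ Ts lastα ≡ length Ts
    uniform-last = begin
      (2 ^ k) ^ i * ∑ Ts lastα                                               ≡⟨ ∑-∏-simpleTab (prefix ρ) (λ x u → 𝟙 ((offset ρ x ⊕ u) == α)) t prefixes-independent ⟩
      length Ts * ∏ (Vec.map (λ x → ∑[ u ∈ allBits k ] 𝟙 ((offset ρ x ⊕ u) == α)) t) ≡⟨ cong (length Ts *_) (∏-map-1 _ hits-α-once t) ⟩
      length Ts * 1                                                      ≡⟨ *-identityʳ _ ⟩
      length Ts                                                          ∎
      where
      hits-α-once : ∀ x → ∑[ u ∈ allBits k ] 𝟙 ((offset ρ x ⊕ u) == α) ≡ 1
      hits-α-once x = trans (∑-cong (allBits k) λ u → cong (λ v → 𝟙 (v == α)) (⊕-comm (offset ρ x) u))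
                            (trans (∑-allBits-⊕ k (offset ρ x) (λ v → 𝟙 (v == α))) (allBits-enumeration k α))
    uniform-hash : (2 ^ r) ^ i * ∑ T̂s selected ≡ length T̂s * ∏ (Vec.map q t)
    uniform-hash = ∑-∏-simpleTab (λ x → prefix ρ x ∷ʳ α) (λ x u → 𝟙 (φ x u)) t
                     (Independent-∷ʳ (prefix ρ) α t prefixes-independent)

  good-bound : ∀ {i} (t : Vec Key i) → ∑[ H ∈ tornados ] good H t * ((2 ^ k) ^ i * (2 ^ r) ^ i) ≤ Ω * ∏ (Vec.map q t)
  good-bound {i} t = begin
    ∑[ H ∈ tornados ] good H t * K                                      ≡⟨ cong (_* K) (∑-allTornado _) ⟩
    ∑[ ρ ∈ contexts ] ∑[ T ∈ Ts ] ∑[ T̂ ∈ T̂s ] good (assemble ρ T T̂) t * K ≡⟨ *-distribʳ-∑ K contexts _ ⟩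
    ∑[ ρ ∈ contexts ] (∑[ T ∈ Ts ] ∑[ T̂ ∈ T̂s ] good (assemble ρ T T̂) t * K) ≤⟨ ∑-mono-≤ contexts (λ ρ → good-context ρ t) ⟩
    ∑[ ρ ∈ contexts ] (length Ts * (length T̂s * ∏ (Vec.map q t)))       ≡⟨ ∑-cong contexts (λ ρ → ∑-const Ts _) ⟨
    ∑[ ρ ∈ contexts ] ∑[ T ∈ Ts ] (length T̂s * ∏ (Vec.map q t))         ≡⟨ ∑-tornados-const _ ⟩
    Ω * ∏ (Vec.map q t)                                                 ∎
    where
    open ≤-Reasoning
    K : ℕ
    K = (2 ^ k) ^ i * (2 ^ r) ^ i

  mult-Xset : ∀ (H : Tornado k r c₀ d) β → mult β (Xset φ H) ≡ 𝟙 (φ β (hash H β)) * 1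
  mult-Xset H β = trans (mult-filter (λ x → φ x (hash H x)) keys β) (cong (𝟙 (φ β (hash H β)) *_) (keys-enumeration β))

  mult-Xα : ∀ (H : Tornado k r c₀ d) β → mult β (Xα φ H α) ≡ 𝟙 (last (derived H β) == α) * mult β (Xset φ H)
  mult-Xα H β = mult-filter (λ x → last (derived H x) == α) (Xset φ H) β

  Xset-once : ∀ (H : Tornado k r c₀ d) → AtMostOnce (Xset φ H)
  Xset-once H β = subst (_≤ 1) (sym (mult-Xset H β)) (*-mono-≤ (𝟙≤1 (φ β (hash H β))) ≤-refl)

  Xα⊆Xset : ∀ (H : Tornado k r c₀ d) β → mult β (Xα φ H α) ≤ mult β (Xset φ H)
  Xα⊆Xset H β = subst (_≤ mult β (Xset φ H)) (sym (mult-Xα H β))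
                      (≤-trans (*-monoˡ-≤ (mult β (Xset φ H)) (𝟙≤1 (last (derived H β) == α))) (≤-reflexive (*-identityˡ _)))

  Xα-once : ∀ (H : Tornado k r c₀ d) → AtMostOnce (Xα φ H α)
  Xα-once H β = ≤-trans (Xα⊆Xset H β) (Xset-once H β)

  Xα-inXα : ∀ (H : Tornado k r c₀ d) x → 1 ≤ mult x (Xα φ H α) → inXα H x ≡ true
  Xα-inXα H x x∈Xα =
    both (last (derived H x) == α) (φ x (hash H x)) (subst (1 ≤_) (trans (mult-Xα H x) (cong (𝟙 (last (derived H x) == α) *_) (mult-Xset H x))) x∈Xα)
    where
    both : ∀ a b → 1 ≤ 𝟙 a * (𝟙 b * 1) → a ∧ b ≡ true
    both true  true  _ = refl
    both true  false ()
    both false _     ()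

  -- On 𝒥, every tuple of distinct keys of X_α is good: its prefixes form a subfamily of X's.
  distinctIn≤good : ∀ {i} (H : Tornado k r c₀ d) → 𝒥 φ H ≡ true → (t : Vec Key i) → distinctIn (Xα φ H α) t ≤ good H t
  distinctIn≤good H 𝒥-holds t with distinctIn (Xα φ H α) t in eq
  ... | zero  = z≤n
  ... | suc n = subst (_≤ good H t) eq (subst (distinctIn (Xα φ H α) t ≤_) (sym good≡1) (distinctIn-≤1 (Xα-once H) t))
    where
    t⊆Xα : ∀ β → mult β (toList t) ≤ mult β (Xα φ H α)
    t⊆Xα = distinctIn-⊆ (Xα φ H α) t {{subst NonZero (sym eq) _}}
    good≡1 : good H t ≡ 1
    good≡1 = cong 𝟙 (cong₂ _∧_
      (linIndependent-⊆ _≟K_ keys keys-enumeration (λ x → init (derived H x)) {toList t} {Xset φ H} (λ β → ≤-trans (t⊆Xα β) (Xα⊆Xset H β)) (Xset-once H) 𝒥-holds)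
      (all-⊆ (inXα H) (Xα φ H α) (toList t) (Xα-inXα H) t⊆Xα))

  i!≤∑good : ∀ i (H : Tornado k r c₀ d) → 𝟙 ((i ≤ᵇ length (Xα φ H α)) ∧ 𝒥 φ H) * i ! ≤ ∑[ t ∈ allVecsOf keys i ] good H t
  i!≤∑good i H with i ≤ᵇ length (Xα φ H α) in large | 𝒥 φ H in 𝒥-holds
  ... | false | _     = z≤n
  ... | true  | false = z≤n
  ... | true  | true  = begin
    1 * i !                                    ≡⟨ *-identityˡ _ ⟩
    i !                                        ≤⟨ i!≤∑distinctIn keys-enumeration i (Xα-once H) (≤ᵇ⇒≤ i _ (subst T (sym large) tt)) ⟩
    ∑ (allVecsOf keys i) (distinctIn (Xα φ H α)) ≤⟨ ∑-mono-≤ (allVecsOf keys i) (distinctIn≤good H 𝒥-holds) ⟩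
    ∑[ t ∈ allVecsOf keys i ] good H t         ∎
    where open ≤-Reasoning

  ∑-∏q : ∀ i → ∑[ t ∈ allVecsOf keys i ] ∏ (Vec.map q t) ≡ Q ^ i
  ∑-∏q i = begin
    ∑[ t ∈ allVecsOf keys i ] ∏ (Vec.map q t)              ≡⟨ ∑-cong (allVecsOf keys i) (λ t → cong ∏ (VecP.map-is-⊛ q t)) ⟩
    ∑[ t ∈ allVecsOf keys i ] ∏ (replicate i q ⊛ t)        ≡⟨ ∑-allVecsOf-∏ keys (replicate i q) ⟩
    ∏ (Vec.map (∑ keys) (replicate i q))                   ≡⟨ cong ∏ (VecP.map-replicate (∑ keys) q i) ⟩
    ∏ (replicate i Q)                                      ≡⟨ ∏-replicate i ⟩
    Q ^ i                                                  ∎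
    where
    open ≡-Reasoning
    ∏-replicate : ∀ n → ∏ (replicate n Q) ≡ Q ^ n
    ∏-replicate zero    = refl
    ∏-replicate (suc n) = cong (Q *_) (∏-replicate n)

  event-bound : ∀ i → #Event {k} {r} {c₀} {d} φ α i * i ! * ((2 ^ k) ^ i * (2 ^ r) ^ i) ≤ Ω * Q ^ i
  event-bound i = begin
    #Event φ α i * i ! * K                                                       ≡⟨ cong (λ n → n * i ! * K) (count≡∑𝟙 _ tornados) ⟩
    ∑[ H ∈ tornados ] 𝟙 ((i ≤ᵇ length (Xα φ H α)) ∧ 𝒥 φ H) * i ! * K           ≡⟨ cong (_* K) (*-distribʳ-∑ (i !) tornados _) ⟩
    ∑[ H ∈ tornados ] (𝟙 ((i ≤ᵇ length (Xα φ H α)) ∧ 𝒥 φ H) * i !) * K         ≤⟨ *-monoˡ-≤ K (∑-mono-≤ tornados (i!≤∑good i)) ⟩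
    ∑[ H ∈ tornados ] ∑[ t ∈ allVecsOf keys i ] good H t * K                   ≡⟨ cong (_* K) (∑-comm tornados (allVecsOf keys i) _) ⟩
    ∑[ t ∈ allVecsOf keys i ] ∑[ H ∈ tornados ] good H t * K                   ≡⟨ *-distribʳ-∑ K (allVecsOf keys i) _ ⟩
    ∑[ t ∈ allVecsOf keys i ] (∑[ H ∈ tornados ] good H t * K)                 ≤⟨ ∑-mono-≤ (allVecsOf keys i) good-bound ⟩
    ∑[ t ∈ allVecsOf keys i ] (Ω * ∏ (Vec.map q t))                            ≡⟨ *-distribˡ-∑ Ω (allVecsOf keys i) _ ⟨
    Ω * ∑[ t ∈ allVecsOf keys i ] ∏ (Vec.map q t)                              ≡⟨ cong (Ω *_) (∑-∏q i) ⟩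
    Ω * Q ^ i                                                                  ∎
    where
    open ≤-Reasoning
    K : ℕ
    K = (2 ^ k) ^ i * (2 ^ r) ^ i

lemma9 : (k r c₀ d : ℕ) (S : Fin r → Bool) (φ : Vec (Bits k) (suc c₀) → Bits r → Bool) →
    DependsOnlyOn S φ →
    (α : Bits k) (i : ℕ) →
    #Event {k} {r} {c₀} {d} φ α i * (i !) * (#Ω k r c₀ d ^ i) * ((2 ^ k) ^ i)
    ≤ (ΣX {k} {r} {c₀} {d} φ ^ i) * #Ω k r c₀ d
lemma9 k r c₀ d _ φ _ α i = *-cancelʳ-≤ _ _ ((2 ^ r) ^ i) {{m^n≢0 (2 ^ r) i {{m^n≢0 2 r}}}} (begin
  E * i ! * Ω ^ i * (2 ^ k) ^ i * (2 ^ r) ^ i        ≡⟨ solve 5 (λ E f ω K R → E :* f :* ω :* K :* R := E :* f :* (K :* R) :* ω) refl E (i !) (Ω ^ i) ((2 ^ k) ^ i) ((2 ^ r) ^ i) ⟩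
  E * i ! * ((2 ^ k) ^ i * (2 ^ r) ^ i) * Ω ^ i      ≤⟨ *-monoˡ-≤ (Ω ^ i) (event-bound i) ⟩
  Ω * Q ^ i * Ω ^ i                                  ≡⟨ solve 3 (λ ω q ωⁱ → ω :* q :* ωⁱ := ωⁱ :* q :* ω) refl Ω (Q ^ i) (Ω ^ i) ⟩
  Ω ^ i * Q ^ i * Ω                                  ≡⟨ cong (_* Ω) (^-distribʳ-* Ω Q i) ⟨
  (Ω * Q) ^ i * Ω                                    ≡⟨ cong (λ n → n ^ i * Ω) expected-size ⟨
  (ΣX φ * 2 ^ r) ^ i * Ω                             ≡⟨ cong (_* Ω) (^-distribʳ-* (ΣX φ) (2 ^ r) i) ⟩
  ΣX φ ^ i * (2 ^ r) ^ i * Ω                         ≡⟨ solve 3 (λ x R ω → x :* R :* ω := x :* ω :* R) refl (ΣX φ ^ i) ((2 ^ r) ^ i) Ω ⟩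
  ΣX φ ^ i * Ω * (2 ^ r) ^ i                         ∎)
  where
  open TailBound k r c₀ d φ α
  open ≤-Reasoning
  open +-*-Solver
  E : ℕ
  E = #Event {k} {r} {c₀} {d} φ α i
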